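{- Let $n,p,q,r$ be positive integers. Then $$ \sum_{\ell=0}^n \ell^{p}H_{n-\ell}^{(q,r)}=\sum_{y=0}^{p+r} c(p,r,n,y)\, H_{n-1}^{(q-y)}, $$ where $$ c(p,r,n,y)=\sum_{\substack{m+t=y\\ 0 \le m\le r-1\\ 0 \le t \le p+r-m}}\ \sum_{k=\max\{0,t-p-1\}}^{r-1-m} a_{7}(p+k,n,t)\, a_{8}(r,m,k,n), $$ with $$ a_{6}(\ell,n,t)=\frac{1}{(\ell+1)!}\sum_{i=t}^{\ell+1} s(\ell+1,i) \binom{i}{t} (-1)^{t} (n+1)^{i-t},\qquad a_{7}(p,n,t)=\sum_{\ell=1}^{p} S(p,\ell)\,\ell!\, a_{6}(\ell,n,t), $$ $$ a_{8}(r,m,k,n)=\sum_{j=k}^{r-1-m}\hat{a}(r,m,j) \binom{j}{k} (-1)^{k} n^{j-k}. $$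
   Context: For every integer $m$ (possibly zero or negative) and $N\ge 0$, $H_N^{(m)}=\sum_{j=1}^N j^{ -m}$ (so $H_0^{(m)}=0$). Generalized hyperharmonic numbers: $H_N^{(q,1)}=H_N^{(q)}$ and $H_N^{(q,r)}=\sum_{j=1}^N H_j^{(q,r-1)}$ for $r\ge2$, $N\ge0$. $S(p,\ell)$ are Stirling numbers of the second kind ($x^p=\sum_\ell S(p,\ell)x(x-1)\cdots(x-\ell+1)$) and $s(k,i)$ the signed Stirling numbers of the first kind ($x(x-1)\cdots(x-k+1)=\sum_i s(k,i)x^i$). Empty sums are $0$; $0^0=1$. Bernoulli numbers $B_m^{+}$ are defined by $\frac{x}{1-e^{ -x}}=\sum_{m\ge0}B_m^{+}\frac{x^m}{m!}$. The numbers $\hat a(r,m,j)$, for $r\ge1$, $0\le m\le r-1$, $0\le j\le r-1-m$, are defined recursively by $\hat a(1,0,0)=1$ and, for $r\ge1$: $\hat{a}(r+1,r,0)=-\sum_{m=0}^{r-1} \hat{a}(r,m,r-m-1)\frac{1}{r-m}$; $\hat{a}(r+1,m,\ell)=\sum_{j=\ell-1}^{r-1-m} \frac{\hat{a}(r,m,j)}{j+1} \binom{j+1}{j-\ell+1}B_{j-\ell+1}^{+}$ for $0\le m\le r-1$, $1\le \ell\le r-m$; $\hat{a}(r+1,m,0)=-\sum_{y=0}^{m} \sum_{j=\max\{0, m-y-1\}}^{r-1-y}\hat{a}(r,y,j)D(r,m,j,y)$ for $0\le m\le r-1$, where $D(r,m,j,y)=\sum_{\ell=\max\{0, m-y-1\}}^{j}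 \frac{1}{j+1} \binom{j+1}{j-\ell}B_{j-\ell}^{+}\binom{\ell+1}{m-y}(-1)^{1+\ell-m+y}$. -}

module Defs where

open import Data.Nat as ℕ using (ℕ; zero; suc; _∸_; _≤ᵇ_; _≡ᵇ_; _!)
open import Data.Nat.Combinatorics using (_C_)
open import Data.Integer as ℤ using (ℤ; +_; -[1+_])
open import Data.Rational using (ℚ; _/_; _+_; _*_; _-_; -_; 0ℚ; 1ℚ)
open import Data.Bool using (Bool; true; false; if_then_else_; _∧_)

ℕ→ℚ : ℕ → ℚ
ℕ→ℚ n = + n / 1

ℤ→ℚ : ℤ → ℚ
ℤ→ℚ z = z / 1

-- 1/d for d ≥ 1 (junk value 0 at d = 0, never used)
recipℕ : ℕ → ℚ
recipℕ zero = 0ℚ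
recipℕ (suc d) = + 1 / suc d

sgn : ℕ → ℚ
sgn zero = 1ℚ
sgn (suc k) = - sgn k

sumFrom : ℕ → ℕ → (ℕ → ℚ) → ℚ
sumFrom a zero f = 0ℚ
sumFrom a (suc len) f = f a + sumFrom (suc a) len f

-- Σ_{i = a}^{b} f i  (empty, i.e. 0, when b < a)
sumRange : ℕ → ℕ → (ℕ → ℚ) → ℚ
sumRange a b f = sumFrom a (suc b ∸ a) f

-- j^{-m} for j = suc j' ≥ 1 and m ∈ ℤ
powNeg : ℕ → ℤ → ℚ
powNeg j (+ k) = recipℕ (j ℕ.^ k)
powNeg j -[1+ k ] = ℕ→ℚ (j ℕ.^ suc k)

H : ℤ → ℕ → ℚ
H m N = sumRange 1 N (λ j → powNeg j m)

-- generalized hyperharmonic numbers H_N^{(q,r)} (r ≥ 1; value at r = 0 is junk 0)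
HH : ℤ → ℕ → ℕ → ℚ
HH q zero N = 0ℚ
HH q (suc zero) N = H q N
HH q (suc (suc r)) N = sumRange 1 N (λ j → HH q (suc r) j)

S₂ : ℕ → ℕ → ℕ
S₂ zero zero = 1
S₂ zero (suc l) = 0
S₂ (suc p) zero = 0
S₂ (suc p) (suc l) = suc l ℕ.* S₂ p (suc l) ℕ.+ S₂ p l

s₁ : ℕ → ℕ → ℤ
s₁ zero zero = + 1
s₁ zero (suc i) = + 0
s₁ (suc k) zero = + 0
s₁ (suc k) (suc i) = s₁ k i ℤ.- (+ k) ℤ.* s₁ k (suc i)

-- Bernoulli numbers B⁺: x/(1-e^{-x}) = Σ B⁺_m x^m/m!.
-- Comparing coefficients in (1 - e^{-x}) · Σ B⁺_k x^k/k! = x gives, for every m ≥ 0,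
--   (m+1) B⁺_m = [m = 0] - Σ_{i=2}^{m+1} C(m+1,i) (-1)^{i+1} B⁺_{m+1-i}.
-- bernTab m k = B⁺_k for k ≤ m.
bernTab : ℕ → ℕ → ℚ
bernTab zero k = 1ℚ
bernTab (suc m) k =
  if k ≤ᵇ m then bernTab m k
  else recipℕ (suc (suc m)) *
         (- sumRange 2 (suc (suc m))
              (λ i → ℕ→ℚ (suc (suc m) C i) * sgn (suc i) * bernTab m (suc (suc m) ∸ i)))

B⁺ : ℕ → ℚ
B⁺ m = bernTab m m

D : ℕ → ℕ → ℕ → ℕ → ℚ
D r m j y = sumRange (m ∸ y ∸ 1) j (λ l →
  recipℕ (suc j) * ℕ→ℚ (suc j C (j ∸ l)) * B⁺ (j ∸ l)
    * ℕ→ℚ (suc l C (m ∸ y)) * sgn (1 ℕ.+ l ℕ.+ m ℕ.+ y))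
  -- (-1)^{1+ℓ-m+y} = (-1)^{1+ℓ+m+y}

âStep : ℕ → (ℕ → ℕ → ℚ) → ℕ → ℕ → ℚ
âStep r a m zero =
  if m ≡ᵇ r then - sumRange 0 (r ∸ 1) (λ m' → a m' (r ∸ m' ∸ 1) * recipℕ (r ∸ m'))
  else if suc m ≤ᵇ r then
    - sumRange 0 m (λ y → sumRange (m ∸ y ∸ 1) (r ∸ 1 ∸ y) (λ j → a y j * D r m j y))
  else 0ℚ
âStep r a m (suc l) =
  if (suc m ≤ᵇ r) ∧ (suc l ≤ᵇ r ∸ m) then
    sumRange l (r ∸ 1 ∸ m) (λ j →
      a m j * recipℕ (suc j) * ℕ→ℚ (suc j C (suc j ∸ suc l)) * B⁺ (suc j ∸ suc l))
  else 0ℚ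

-- â(r,m,j)  (r ≥ 1; out-of-range values are junk 0)
â : ℕ → ℕ → ℕ → ℚ
â zero m j = 0ℚ
â (suc zero) zero zero = 1ℚ
â (suc zero) _ _ = 0ℚ
â (suc (suc r)) m j = âStep (suc r) (â (suc r)) m j

a₆ : ℕ → ℕ → ℕ → ℚ
a₆ l n t = recipℕ (suc l !) *
  sumRange t (suc l) (λ i →
    ℤ→ℚ (s₁ (suc l) i) * ℕ→ℚ (i C t) * sgn t * ℕ→ℚ (suc n ℕ.^ (i ∸ t)))

a₇ : ℕ → ℕ → ℕ → ℚ
a₇ p n t = sumRange 1 p (λ l → ℕ→ℚ (S₂ p l) * ℕ→ℚ (l !) * a₆ l n t)

a₈ : ℕ → ℕ → ℕ → ℕ → ℚ
a₈ r m k n = sumRange k (r ∸ 1 ∸ m) (λ j →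
  â r m j * ℕ→ℚ (j C k) * sgn k * ℕ→ℚ (n ℕ.^ (j ∸ k)))

c : ℕ → ℕ → ℕ → ℕ → ℚ
c p r n y = sumRange 0 (r ∸ 1) (λ m → sumRange 0 (p ℕ.+ r ∸ m) (λ t →
  if m ℕ.+ t ≡ᵇ y
  then sumRange (t ∸ (p ℕ.+ 1)) (r ∸ 1 ∸ m) (λ k → a₇ (p ℕ.+ k) n t * a₈ r m k n)
  else 0ℚ))

-- Put T_r(x, Y) = Σ_{m,j<r} â(r,m,j) x^j Y^m and let F_j be the Faulhaber polynomial, Σ_{k=1}^N k^j = F_j(N).
-- The recursion for â is designed so that T_{r+1}(x, Y) = Σ â(r,m,j) (F_j(x) - F_j(Y - 1)) Y^m, i.e.
-- T_{r+1}(N, i) = Σ_{k=i}^N T_r(k, i); with T_1 = 1 this gives H_N^{(q,r)} = Σ_{i=1}^N T_r(N, i) i^(-q).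
-- Hence the left side equals Σ_{i=1}^{n-1} i^(-q) Σ_{x=0}^{n-i} x^p T_r(n-x, i).  On the right,
-- H_{n-1}^{(q-y)} = Σ_i i^(-q) i^y, and c(p,r,n,y) is the coefficient of i^y in that same inner sum:
-- a₈ re-expands T_r(n-x, i) in powers of x, and a₇(P,n,·) are the coefficients of i ↦ Σ_{x=0}^{n-i} x^P,
-- obtained from x^P = Σ_ℓ S(P,ℓ) ℓ! C(x,ℓ), the hockey-stick identity and ℓ! C(y,ℓ) = Σ_i s(ℓ,i) y^i.

module Submission where

open import Defs

module HyperharmonicConvolution where
  open import Algebra.Bundles using (CommutativeRing)
  open import Data.Bool using (true; false; if_then_else_; T; _∧_)
  open import Data.Empty using (⊥-elim)
  open import Data.Fin as Fin using (Fin; toℕ)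
  open import Data.Integer as ℤ using (+_)
  import Data.Integer.Properties as ℤₚ
  open import Data.Nat as ℕ using (ℕ; zero; suc; _∸_; _≤_; _<_; _≡ᵇ_; _≤ᵇ_; z≤n; s≤s; z<s; _!)
  open import Data.Nat.Combinatorics
    using (_C_; k>n⇒nCk≡0; nCn≡1; nC1≡n; nCk+nC[k+1]≡[n+1]C[k+1]; nCk≡nC[n∸k]; nCk≡n!/k![n-k]!; k![n∸k]!∣n!)
  import Data.Nat.DivMod as DivMod
  import Data.Nat.Properties as ℕₚ
  open import Data.Nat.Tactic.RingSolver using (solve-∀)
  open import Data.Product using (_,_)
  open import Data.Rational using (ℚ; toℚᵘ; _+_; _*_; _-_; -_; 0ℚ; 1ℚ; +-0-rawMonoid)
  import Data.Rational.Properties as ℚₚ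
  open import Data.Rational.Solver using (module +-*-Solver)
  import Data.Rational.Unnormalised as ℚᵘ
  import Data.Rational.Unnormalised.Properties as ℚᵘₚ
  open import Data.Sum using (_⊎_; inj₁; inj₂; [_,_]′)
  open import Function using (_∘_)
  open import Relation.Binary.Definitions using (Tri; tri<; tri≈; tri>)
  open import Relation.Binary.PropositionalEquality
    using (_≡_; _≢_; refl; sym; trans; cong; cong₂; subst; module ≡-Reasoning)
  open import Relation.Nullary using (¬_; Dec; yes; no; contradiction)

  open import Algebra.Definitions.RawMonoid +-0-rawMonoid using (sum; _×_)
  open CommutativeRing ℚₚ.+-*-commutativeRing using (commutativeSemiring; semiring)
  open import Algebra.Properties.Semiring.Exp semiring using (^-homo-*) renaming (_^_ to _^ℚ_)
  open import Algebra.Properties.CommutativeSemiring.Exp commutativeSemiring using (^-distrib-*)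
  import Algebra.Properties.CommutativeSemiring.Binomial commutativeSemiring as Binomial
  open +-*-Solver using (solve; _:=_; _:+_; _:*_; :-_; _:-_; con)
  open ≡-Reasoning

  toℚᵘ-ℤ→ℚ : ∀ z → toℚᵘ (ℤ→ℚ z) ℚᵘ.≃ ℚᵘ.mkℚᵘ z 0
  toℚᵘ-ℤ→ℚ z = ℚₚ.toℚᵘ-fromℚᵘ (ℚᵘ.mkℚᵘ z 0)

  ℤ→ℚ-+ : ∀ a b → ℤ→ℚ (a ℤ.+ b) ≡ ℤ→ℚ a + ℤ→ℚ b
  ℤ→ℚ-+ a b = ℚₚ.toℚᵘ-injective (ℚᵘₚ.≃-trans (toℚᵘ-ℤ→ℚ (a ℤ.+ b)) (ℚᵘₚ.≃-trans
    (ℚᵘ.*≡* (cong (ℤ._* + 1) (cong₂ ℤ._+_ (sym (ℤₚ.*-identityʳ a)) (sym (ℤₚ.*-identityʳ b)))))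
    (ℚᵘₚ.≃-sym (ℚᵘₚ.≃-trans (ℚₚ.toℚᵘ-homo-+ (ℤ→ℚ a) (ℤ→ℚ b)) (ℚᵘₚ.+-cong (toℚᵘ-ℤ→ℚ a) (toℚᵘ-ℤ→ℚ b))))))

  ℤ→ℚ-* : ∀ a b → ℤ→ℚ (a ℤ.* b) ≡ ℤ→ℚ a * ℤ→ℚ b
  ℤ→ℚ-* a b = ℚₚ.toℚᵘ-injective (ℚᵘₚ.≃-trans (toℚᵘ-ℤ→ℚ (a ℤ.* b)) (ℚᵘₚ.≃-trans (ℚᵘ.*≡* refl)
    (ℚᵘₚ.≃-sym (ℚᵘₚ.≃-trans (ℚₚ.toℚᵘ-homo-* (ℤ→ℚ a) (ℤ→ℚ b)) (ℚᵘₚ.*-cong (toℚᵘ-ℤ→ℚ a) (toℚᵘ-ℤ→ℚ b))))))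

  ℤ→ℚ-neg : ∀ a → ℤ→ℚ (ℤ.- a) ≡ - ℤ→ℚ a
  ℤ→ℚ-neg a = ℚₚ.toℚᵘ-injective (ℚᵘₚ.≃-trans (toℚᵘ-ℤ→ℚ (ℤ.- a))
    (ℚᵘₚ.≃-sym (ℚᵘₚ.≃-trans (ℚₚ.toℚᵘ-homo‿- (ℤ→ℚ a)) (ℚᵘₚ.-‿cong (toℚᵘ-ℤ→ℚ a)))))

  ℤ→ℚ-- : ∀ a b → ℤ→ℚ (a ℤ.- b) ≡ ℤ→ℚ a - ℤ→ℚ b
  ℤ→ℚ-- a b = trans (ℤ→ℚ-+ a (ℤ.- b)) (cong (_+_ (ℤ→ℚ a)) (ℤ→ℚ-neg b))

  ℕ→ℚ-+ : ∀ a b → ℕ→ℚ (a ℕ.+ b) ≡ ℕ→ℚ a + ℕ→ℚ b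
  ℕ→ℚ-+ a b = ℤ→ℚ-+ (+ a) (+ b)

  ℕ→ℚ-* : ∀ a b → ℕ→ℚ (a ℕ.* b) ≡ ℕ→ℚ a * ℕ→ℚ b
  ℕ→ℚ-* a b = trans (cong ℤ→ℚ (ℤₚ.pos-* a b)) (ℤ→ℚ-* (+ a) (+ b))

  ℕ→ℚ-∸ : ∀ {a b} → b ≤ a → ℕ→ℚ (a ∸ b) ≡ ℕ→ℚ a - ℕ→ℚ b
  ℕ→ℚ-∸ {a} {b} b≤a = begin
    ℕ→ℚ (a ∸ b)                        ≡⟨ solve 2 (λ x y → x := (x :+ y) :- y) refl (ℕ→ℚ (a ∸ b)) (ℕ→ℚ b) ⟩
    (ℕ→ℚ (a ∸ b) + ℕ→ℚ b) - ℕ→ℚ b      ≡⟨ cong (_- ℕ→ℚ b) (sym (ℕ→ℚ-+ (a ∸ b) b)) ⟩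
    ℕ→ℚ (a ∸ b ℕ.+ b) - ℕ→ℚ b          ≡⟨ cong (λ c → ℕ→ℚ c - ℕ→ℚ b) (ℕₚ.m∸n+n≡m b≤a) ⟩
    ℕ→ℚ a - ℕ→ℚ b                      ∎

  ℕ→ℚ-^ : ∀ a k → ℕ→ℚ (a ℕ.^ k) ≡ ℕ→ℚ a ^ℚ k
  ℕ→ℚ-^ a zero = refl
  ℕ→ℚ-^ a (suc k) = trans (ℕ→ℚ-* a (a ℕ.^ k)) (cong (ℕ→ℚ a *_) (ℕ→ℚ-^ a k))

  recipℕ-inverseˡ : ∀ {n} → 1 ≤ n → recipℕ n * ℕ→ℚ n ≡ 1ℚ
  recipℕ-inverseˡ {suc d} _ = ℚₚ.toℚᵘ-injective (ℚᵘₚ.≃-trans (ℚₚ.toℚᵘ-homo-* (recipℕ (suc d)) (ℕ→ℚ (suc d)))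
    (ℚᵘₚ.≃-trans (ℚᵘₚ.*-cong (ℚₚ.toℚᵘ-fromℚᵘ (ℚᵘ.mkℚᵘ (+ 1) d)) (toℚᵘ-ℤ→ℚ (+ suc d)))
      (ℚᵘ.*≡* (ℤₚ.*-assoc (+ 1) (+ suc d) (+ 1)))))

  ≡ᵇ-refl : ∀ n → (n ≡ᵇ n) ≡ true
  ≡ᵇ-refl zero = refl
  ≡ᵇ-refl (suc n) = ≡ᵇ-refl n

  m+n≡ᵇm : ∀ m n → (m ℕ.+ n ≡ᵇ m) ≡ (n ≡ᵇ 0)
  m+n≡ᵇm zero n = refl
  m+n≡ᵇm (suc m) n = m+n≡ᵇm m n

  ≡ᵇ-false : ∀ {k m} → ¬ k ≡ m → (k ≡ᵇ m) ≡ false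
  ≡ᵇ-false {k} {m} k≢m with k ≡ᵇ m in eq
  ... | false = refl
  ... | true  = contradiction (ℕₚ.≡ᵇ⇒≡ k m (subst T (sym eq) _)) k≢m

  ≤ᵇ-true : ∀ {k m} → k ≤ m → (k ≤ᵇ m) ≡ true
  ≤ᵇ-true {k} {m} k≤m with k ≤ᵇ m in eq
  ... | true  = refl
  ... | false = ⊥-elim (subst T eq (ℕₚ.≤⇒≤ᵇ k≤m))

  ≤ᵇ-false : ∀ {k m} → m < k → (k ≤ᵇ m) ≡ false
  ≤ᵇ-false {k} {m} m<k with k ≤ᵇ m in eq
  ... | false = refl
  ... | true  = contradiction (ℕₚ.≤ᵇ⇒≤ k m (subst T (sym eq) _)) (ℕₚ.<⇒≱ m<k)

  -- Case splits on goals involving ℚ arithmetic go through these lemmas and auxiliary functions rather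
  -- than `with`/`rewrite`: abstracting such a goal normalises it, and the record patterns of ℚ's
  -- operations then unfold it into enormous terms.
  if-true : ∀ {b} {x y : ℚ} → b ≡ true → (if b then x else y) ≡ x
  if-true refl = refl

  if-false : ∀ {b} {x y : ℚ} → b ≡ false → (if b then x else y) ≡ y
  if-false refl = refl

  sumFrom-cong : ∀ a len {f g : ℕ → ℚ} → (∀ i → a ≤ i → i < a ℕ.+ len → f i ≡ g i) →
                 sumFrom a len f ≡ sumFrom a len g
  sumFrom-cong a zero eq = refl
  sumFrom-cong a (suc len) eq = cong₂ _+_ (eq a ℕₚ.≤-refl (ℕₚ.m<m+n a z<s))
    (sumFrom-cong (suc a) len (λ i a<i i<a+len → eq i (ℕₚ.<⇒≤ a<i) (subst (i <_) (sym (ℕₚ.+-suc a len)) i<a+len)))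

  sumFrom-cong′ : ∀ a len {f g : ℕ → ℚ} → (∀ i → f i ≡ g i) → sumFrom a len f ≡ sumFrom a len g
  sumFrom-cong′ a len eq = sumFrom-cong a len (λ i _ _ → eq i)

  sumFrom-zero : ∀ a len {f : ℕ → ℚ} → (∀ i → a ≤ i → i < a ℕ.+ len → f i ≡ 0ℚ) → sumFrom a len f ≡ 0ℚ
  sumFrom-zero a len eq = trans (sumFrom-cong a len eq) (sumFrom-0 a len)
    where
    sumFrom-0 : ∀ a len → sumFrom a len (λ _ → 0ℚ) ≡ 0ℚ
    sumFrom-0 a zero = refl
    sumFrom-0 a (suc len) = trans (ℚₚ.+-identityˡ _) (sumFrom-0 (suc a) len)

  sumFrom-+ : ∀ a len (f g : ℕ → ℚ) → sumFrom a len (λ i → f i + g i) ≡ sumFrom a len f + sumFrom a len g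
  sumFrom-+ a zero f g = refl
  sumFrom-+ a (suc len) f g = trans (cong (_+_ (f a + g a)) (sumFrom-+ (suc a) len f g))
    (solve 4 (λ a b c d → (a :+ b) :+ (c :+ d) := (a :+ c) :+ (b :+ d)) refl (f a) (g a) _ _)

  *-distribˡ-sumFrom : ∀ a len c (f : ℕ → ℚ) → c * sumFrom a len f ≡ sumFrom a len (λ i → c * f i)
  *-distribˡ-sumFrom a zero c f = ℚₚ.*-zeroʳ c
  *-distribˡ-sumFrom a (suc len) c f =
    trans (ℚₚ.*-distribˡ-+ c (f a) _) (cong (_+_ (c * f a)) (*-distribˡ-sumFrom (suc a) len c f))

  *-distribʳ-sumFrom : ∀ a len c (f : ℕ → ℚ) → sumFrom a len f * c ≡ sumFrom a len (λ i → f i * c)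
  *-distribʳ-sumFrom a len c f = trans (ℚₚ.*-comm _ c)
    (trans (*-distribˡ-sumFrom a len c f) (sumFrom-cong′ a len (λ i → ℚₚ.*-comm c (f i))))

  neg-distrib-sumFrom : ∀ a len (f : ℕ → ℚ) → - sumFrom a len f ≡ sumFrom a len (λ i → - f i)
  neg-distrib-sumFrom a zero f = refl
  neg-distrib-sumFrom a (suc len) f =
    trans (ℚₚ.neg-distrib-+ (f a) _) (cong (_+_ (- f a)) (neg-distrib-sumFrom (suc a) len f))

  sumFrom-- : ∀ a len (f g : ℕ → ℚ) → sumFrom a len f - sumFrom a len g ≡ sumFrom a len (λ i → f i - g i)
  sumFrom-- a len f g =
    trans (cong (_+_ (sumFrom a len f)) (neg-distrib-sumFrom a len g)) (sym (sumFrom-+ a len f (λ i → - g i)))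

  sumFrom-suc : ∀ a len (f : ℕ → ℚ) → sumFrom (suc a) len f ≡ sumFrom a len (λ i → f (suc i))
  sumFrom-suc a zero f = refl
  sumFrom-suc a (suc len) f = cong (_+_ (f (suc a))) (sumFrom-suc (suc a) len f)

  sumFrom-split : ∀ a l₁ l₂ (f : ℕ → ℚ) → sumFrom a (l₁ ℕ.+ l₂) f ≡ sumFrom a l₁ f + sumFrom (a ℕ.+ l₁) l₂ f
  sumFrom-split a zero l₂ f = trans (sym (ℚₚ.+-identityˡ _)) (cong (λ b → 0ℚ + sumFrom b l₂ f) (sym (ℕₚ.+-identityʳ a)))
  sumFrom-split a (suc l₁) l₂ f = trans (cong (_+_ (f a)) (sumFrom-split (suc a) l₁ l₂ f))
    (trans (sym (ℚₚ.+-assoc (f a) _ _)) (cong (λ b → (f a + sumFrom (suc a) l₁ f) + sumFrom b l₂ f) (sym (ℕₚ.+-suc a l₁))))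

  sumFrom-last : ∀ a len (f : ℕ → ℚ) → sumFrom a (suc len) f ≡ sumFrom a len f + f (a ℕ.+ len)
  sumFrom-last a len f = trans (cong (λ l → sumFrom a l f) (ℕₚ.+-comm 1 len))
    (trans (sumFrom-split a len 1 f) (cong (_+_ (sumFrom a len f)) (ℚₚ.+-identityʳ _)))

  sumFrom-comm : ∀ a l₁ b l₂ (f : ℕ → ℕ → ℚ) →
    sumFrom a l₁ (λ i → sumFrom b l₂ (f i)) ≡ sumFrom b l₂ (λ j → sumFrom a l₁ (λ i → f i j))
  sumFrom-comm a zero b l₂ f = sym (sumFrom-zero b l₂ (λ _ _ _ → refl))
  sumFrom-comm a (suc l₁) b l₂ f = trans (cong (_+_ (sumFrom b l₂ (f a))) (sumFrom-comm (suc a) l₁ b l₂ f))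
    (sym (sumFrom-+ b l₂ (f a) (λ j → sumFrom (suc a) l₁ (λ i → f i j))))

  sumFrom-pad : ∀ a len extra (f : ℕ → ℚ) → (∀ i → a ℕ.+ len ≤ i → i < a ℕ.+ len ℕ.+ extra → f i ≡ 0ℚ) →
    sumFrom a (len ℕ.+ extra) f ≡ sumFrom a len f
  sumFrom-pad a len extra f eq = trans (sumFrom-split a len extra f)
    (trans (cong (_+_ (sumFrom a len f)) (sumFrom-zero (a ℕ.+ len) extra eq)) (ℚₚ.+-identityʳ _))

  sumFrom-single : ∀ a len v (f : ℕ → ℚ) → a ≤ v → v < a ℕ.+ len →
    (∀ i → a ≤ i → i < a ℕ.+ len → i ≢ v → f i ≡ 0ℚ) → sumFrom a len f ≡ f v
  sumFrom-single a zero v f a≤v v<a+0 _ =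
    contradiction (subst (v <_) (ℕₚ.+-identityʳ a) v<a+0) (ℕₚ.≤⇒≯ a≤v)
  sumFrom-single a (suc len) v f a≤v v<a+1+len eq with a ℕₚ.≟ v
  ... | yes refl = trans (cong (_+_ (f a)) (sumFrom-zero (suc a) len (λ i a<i i< → eq i (ℕₚ.<⇒≤ a<i)
                      (subst (i <_) (sym (ℕₚ.+-suc a len)) i<) (ℕₚ.>⇒≢ a<i))))
                     (ℚₚ.+-identityʳ (f a))
  ... | no a≢v = trans (cong (_+ sumFrom (suc a) len f) (eq a ℕₚ.≤-refl (ℕₚ.m<m+n a z<s) a≢v))
      (trans (ℚₚ.+-identityˡ _) (sumFrom-single (suc a) len v f (ℕₚ.≤∧≢⇒< a≤v a≢v)
        (subst (v <_) (ℕₚ.+-suc a len) v<a+1+len)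
        (λ i a<i i< → eq i (ℕₚ.<⇒≤ a<i) (subst (i <_) (sym (ℕₚ.+-suc a len)) i<))))

  sumFrom-indicator : ∀ a len v (g : ℕ → ℚ) → a ≤ v → v < a ℕ.+ len →
    sumFrom a len (λ y → if v ≡ᵇ y then g y else 0ℚ) ≡ g v
  sumFrom-indicator a len v g a≤v v< =
    trans (sumFrom-single a len v _ a≤v v< (λ i _ _ i≢v → cong (if_then g i else 0ℚ) (≡ᵇ-false (i≢v ∘ sym))))
          (cong (if_then g v else 0ℚ) (≡ᵇ-refl v))

  sumFrom-embed : ∀ lo len L (g h : ℕ → ℚ) → lo ℕ.+ len ≤ L →
    (∀ j → j < lo → h j ≡ 0ℚ) → (∀ j → lo ≤ j → j < lo ℕ.+ len → h j ≡ g j) →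
    (∀ j → lo ℕ.+ len ≤ j → j < L → h j ≡ 0ℚ) → sumFrom lo len g ≡ sumFrom 0 L h
  sumFrom-embed lo len L g h lo+len≤L below inside above = sym (begin
    sumFrom 0 L h                                  ≡⟨ cong (λ l → sumFrom 0 l h) L≡ ⟩
    sumFrom 0 (lo ℕ.+ (len ℕ.+ rest)) h            ≡⟨ sumFrom-split 0 lo (len ℕ.+ rest) h ⟩
    sumFrom 0 lo h + sumFrom lo (len ℕ.+ rest) h   ≡⟨ cong₂ _+_ (sumFrom-zero 0 lo (λ j _ → below j))
                                                        (sumFrom-pad lo len rest h (λ j l≤j j< → above j l≤j (subst (j <_) (sym L≡′) j<))) ⟩
    0ℚ + sumFrom lo len h                          ≡⟨ ℚₚ.+-identityˡ _ ⟩
    sumFrom lo len h                               ≡⟨ sumFrom-cong lo len inside ⟩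
    sumFrom lo len g                               ∎)
    where
    rest = L ∸ (lo ℕ.+ len)
    L≡′ : L ≡ lo ℕ.+ len ℕ.+ rest
    L≡′ = sym (ℕₚ.m+[n∸m]≡n lo+len≤L)
    L≡ : L ≡ lo ℕ.+ (len ℕ.+ rest)
    L≡ = trans L≡′ (ℕₚ.+-assoc lo len rest)

  sumRange-embed : ∀ lo hi L (g h : ℕ → ℚ) → hi < L →
    (∀ j → lo ≤ j → j ≤ hi → h j ≡ g j) → (∀ j → j < L → j < lo ⊎ hi < j → h j ≡ 0ℚ) →
    sumRange lo hi g ≡ sumFrom 0 L h
  sumRange-embed lo hi L g h hi<L inside outside with lo ℕₚ.≤? suc hi
  ... | yes lo≤1+hi = sumFrom-embed lo (suc hi ∸ lo) L g h (subst (_≤ L) (sym end≡) hi<L)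
        (λ j j<lo → outside j (ℕₚ.<-≤-trans j<lo (ℕₚ.≤-trans lo≤1+hi hi<L)) (inj₁ j<lo))
        (λ j lo≤j j< → inside j lo≤j (ℕₚ.≤-pred (subst (j <_) end≡ j<)))
        (λ j end≤j j<L → outside j j<L (inj₂ (subst (_≤ j) end≡ end≤j)))
    where
    end≡ : lo ℕ.+ (suc hi ∸ lo) ≡ suc hi
    end≡ = ℕₚ.m+[n∸m]≡n lo≤1+hi
  ... | no lo≰1+hi = trans (cong (λ l → sumFrom lo l g) (ℕₚ.m≤n⇒m∸n≡0 (ℕₚ.<⇒≤ (ℕₚ.≰⇒> lo≰1+hi))))
        (sym (sumFrom-zero 0 L (λ j _ j<L → outside j j<L (side j))))
    where
    side : ∀ j → j < lo ⊎ hi < j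
    side j with j ℕₚ.<? lo
    ... | yes j<lo = inj₁ j<lo
    ... | no j≮lo = inj₂ (ℕₚ.<⇒≤ (ℕₚ.<-≤-trans (ℕₚ.≰⇒> lo≰1+hi) (ℕₚ.≮⇒≥ j≮lo)))

  sumFrom-reverse : ∀ n (f : ℕ → ℚ) → sumFrom 0 n f ≡ sumFrom 0 n (λ i → f (n ∸ suc i))
  sumFrom-reverse zero f = refl
  sumFrom-reverse (suc n) f = begin
    f 0 + sumFrom 1 n f                                         ≡⟨ cong (_+_ (f 0)) (sumFrom-suc 0 n f) ⟩
    f 0 + sumFrom 0 n (f ∘ suc)                                 ≡⟨ cong (_+_ (f 0)) (sumFrom-reverse n (f ∘ suc)) ⟩
    f 0 + sumFrom 0 n (λ i → f (suc (n ∸ suc i)))               ≡⟨ ℚₚ.+-comm (f 0) _ ⟩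
    sumFrom 0 n (λ i → f (suc (n ∸ suc i))) + f 0               ≡⟨ cong₂ _+_ (sumFrom-cong 0 n (λ i _ i<n → cong f (sym (ℕₚ.+-∸-assoc 1 i<n))))
                                                                             (cong f (sym (ℕₚ.n∸n≡0 n))) ⟩
    sumFrom 0 n (λ i → f (suc n ∸ suc i)) + f (suc n ∸ suc n)   ≡⟨ sym (sumFrom-last 0 n (λ i → f (suc n ∸ suc i))) ⟩
    sumFrom 0 (suc n) (λ i → f (suc n ∸ suc i))                 ∎

  sumFrom-antidiagonal : ∀ n (G : ℕ → ℕ → ℚ) →
    sumFrom 0 n (λ m → sumFrom 0 (suc m) (λ a → G a (m ∸ a))) ≡ sumFrom 0 n (λ b → sumFrom 0 (n ∸ b) (λ a → G a b))
  sumFrom-antidiagonal zero G = refl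
  sumFrom-antidiagonal (suc n) G = begin
    sumFrom 0 (suc n) (λ m → sumFrom 0 (suc m) (λ a → G a (m ∸ a)))
      ≡⟨ sumFrom-last 0 n _ ⟩
    sumFrom 0 n (λ m → sumFrom 0 (suc m) (λ a → G a (m ∸ a))) + sumFrom 0 (suc n) (λ a → G a (n ∸ a))
      ≡⟨ cong₂ _+_ (sumFrom-antidiagonal n G) (sumFrom-reverse (suc n) (λ a → G a (n ∸ a))) ⟩
    sumFrom 0 n column + sumFrom 0 (suc n) (λ i → G (n ∸ i) (n ∸ (n ∸ i)))
      ≡⟨ cong₂ _+_ (sym lastColumnEmpty) (sumFrom-cong 0 (suc n) (λ i _ i< → cong (G (n ∸ i)) (ℕₚ.m∸[m∸n]≡n (ℕₚ.≤-pred i<)))) ⟩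
    sumFrom 0 (suc n) column + sumFrom 0 (suc n) (λ b → G (n ∸ b) b)
      ≡⟨ sym (sumFrom-+ 0 (suc n) column (λ b → G (n ∸ b) b)) ⟩
    sumFrom 0 (suc n) (λ b → column b + G (n ∸ b) b)
      ≡⟨ sumFrom-cong 0 (suc n) (λ b _ b< → sym (trans (cong (λ l → sumFrom 0 l (λ a → G a b)) (ℕₚ.+-∸-assoc 1 (ℕₚ.≤-pred b<)))
                                                     (sumFrom-last 0 (n ∸ b) (λ a → G a b)))) ⟩
    sumFrom 0 (suc n) (λ b → sumFrom 0 (suc n ∸ b) (λ a → G a b))
      ∎
    where
    column = λ b → sumFrom 0 (n ∸ b) (λ a → G a b)
    lastColumnEmpty : sumFrom 0 (suc n) column ≡ sumFrom 0 n column
    lastColumnEmpty = trans (sumFrom-last 0 n column)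
      (trans (cong (λ l → sumFrom 0 n column + sumFrom 0 l (λ a → G a n)) (ℕₚ.n∸n≡0 n)) (ℚₚ.+-identityʳ _))

  sumFrom-triangle-comm : ∀ n (G : ℕ → ℕ → ℚ) →
    sumFrom 0 n (λ b → sumFrom 0 (n ∸ b) (λ a → G a b)) ≡ sumFrom 0 n (λ a → sumFrom 0 (n ∸ a) (G a))
  sumFrom-triangle-comm n G = begin
    sumFrom 0 n (λ b → sumFrom 0 (n ∸ b) (λ a → G a b))        ≡⟨ sym (sumFrom-antidiagonal n G) ⟩
    sumFrom 0 n (λ m → sumFrom 0 (suc m) (λ a → G a (m ∸ a)))   ≡⟨ sumFrom-cong′ 0 n (λ m → trans (sumFrom-reverse (suc m) (λ a → G a (m ∸ a)))
                                                                      (sumFrom-cong 0 (suc m) (λ b _ b< → cong (G (m ∸ b)) (ℕₚ.m∸[m∸n]≡n (ℕₚ.≤-pred b<))))) ⟩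
    sumFrom 0 n (λ m → sumFrom 0 (suc m) (λ b → G (m ∸ b) b))   ≡⟨ sumFrom-antidiagonal n (λ b a → G a b) ⟩
    sumFrom 0 n (λ a → sumFrom 0 (n ∸ a) (G a))                 ∎

  sumFrom-triangle-comm₁ : ∀ N (f : ℕ → ℕ → ℚ) →
    sumFrom 1 N (λ k → sumFrom 1 k (f k)) ≡ sumFrom 1 N (λ i → sumFrom i (suc N ∸ i) (λ k → f k i))
  sumFrom-triangle-comm₁ zero f = refl
  sumFrom-triangle-comm₁ (suc N) f = begin
    sumFrom 1 (suc N) (λ k → sumFrom 1 k (f k))                  ≡⟨ sumFrom-last 1 N _ ⟩
    sumFrom 1 N (λ k → sumFrom 1 k (f k)) + sumFrom 1 (suc N) (f (suc N))
      ≡⟨ cong (_+ sumFrom 1 (suc N) (f (suc N))) (trans (sumFrom-triangle-comm₁ N f) (sym lastRowEmpty)) ⟩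
    sumFrom 1 (suc N) row + sumFrom 1 (suc N) (f (suc N))       ≡⟨ sym (sumFrom-+ 1 (suc N) row (f (suc N))) ⟩
    sumFrom 1 (suc N) (λ i → row i + f (suc N) i)                ≡⟨ sumFrom-cong 1 (suc N) (λ i _ i< → sym (extendRow i (ℕₚ.≤-pred i<))) ⟩
    sumFrom 1 (suc N) (λ i → sumFrom i (suc (suc N) ∸ i) (λ k → f k i)) ∎
    where
    row = λ i → sumFrom i (suc N ∸ i) (λ k → f k i)
    lastRowEmpty : sumFrom 1 (suc N) row ≡ sumFrom 1 N row
    lastRowEmpty = trans (sumFrom-last 1 N row)
      (trans (cong (λ l → sumFrom 1 N row + sumFrom (suc N) l (λ k → f k (suc N))) (ℕₚ.n∸n≡0 N)) (ℚₚ.+-identityʳ _))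
    extendRow : ∀ i → i ≤ suc N → sumFrom i (suc (suc N) ∸ i) (λ k → f k i) ≡ row i + f (suc N) i
    extendRow i i≤ = trans (cong (λ l → sumFrom i l (λ k → f k i)) (ℕₚ.+-∸-assoc 1 i≤))
      (trans (sumFrom-last i (suc N ∸ i) (λ k → f k i)) (cong (λ k → row i + f k i) (ℕₚ.m+[n∸m]≡n i≤)))

  sgn≡-1^ : ∀ k → sgn k ≡ (- 1ℚ) ^ℚ k
  sgn≡-1^ zero = refl
  sgn≡-1^ (suc k) = trans (cong -_ (sgn≡-1^ k)) (solve 1 (λ a → :- a := (:- con 1ℚ) :* a) refl ((- 1ℚ) ^ℚ k))

  sgn-+ : ∀ a b → sgn (a ℕ.+ b) ≡ sgn a * sgn b
  sgn-+ zero b = sym (ℚₚ.*-identityˡ (sgn b))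
  sgn-+ (suc a) b = trans (cong -_ (sgn-+ a b)) (ℚₚ.neg-distribˡ-* (sgn a) (sgn b))

  sgn-2+ : ∀ k → sgn (suc (suc k)) ≡ sgn k
  sgn-2+ k = solve 1 (λ a → :- (:- a) := a) refl (sgn k)

  sgn-+-self : ∀ k → sgn (k ℕ.+ k) ≡ 1ℚ
  sgn-+-self zero = refl
  sgn-+-self (suc k) = trans (cong (-_ ∘ sgn) (ℕₚ.+-suc k k)) (trans (sgn-2+ (k ℕ.+ k)) (sgn-+-self k))

  neg-^ : ∀ x s → (- x) ^ℚ s ≡ sgn s * x ^ℚ s
  neg-^ x s = trans (cong (_^ℚ s) (solve 1 (λ x → :- x := (:- con 1ℚ) :* x) refl x))
    (trans (^-distrib-* (- 1ℚ) x s) (cong (_* x ^ℚ s) (sym (sgn≡-1^ s))))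

  0^suc : ∀ k → 0ℚ ^ℚ suc k ≡ 0ℚ
  0^suc k = ℚₚ.*-zeroˡ (0ℚ ^ℚ k)

  sum≡sumFrom : ∀ n (F : Fin n → ℚ) (f : ℕ → ℚ) → (∀ i → F i ≡ f (toℕ i)) → sum F ≡ sumFrom 0 n f
  sum≡sumFrom zero F f eq = refl
  sum≡sumFrom (suc n) F f eq = cong₂ _+_ (eq Fin.zero)
    (trans (sum≡sumFrom n (F ∘ Fin.suc) (f ∘ suc) (eq ∘ Fin.suc)) (sym (sumFrom-suc 0 n f)))

  ×≡ℕ→ℚ* : ∀ n x → n × x ≡ ℕ→ℚ n * x
  ×≡ℕ→ℚ* zero x = sym (ℚₚ.*-zeroˡ x)
  ×≡ℕ→ℚ* (suc n) x = begin
    x + n × x               ≡⟨ cong (_+_ x) (×≡ℕ→ℚ* n x) ⟩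
    x + ℕ→ℚ n * x           ≡⟨ solve 2 (λ x m → x :+ m :* x := (con 1ℚ :+ m) :* x) refl x (ℕ→ℚ n) ⟩
    (1ℚ + ℕ→ℚ n) * x        ≡⟨ cong (_* x) (sym (ℕ→ℚ-+ 1 n)) ⟩
    ℕ→ℚ (suc n) * x         ∎

  binomial-theorem : ∀ x y n → (x + y) ^ℚ n ≡ sumFrom 0 (suc n) (λ k → ℕ→ℚ (n C k) * (x ^ℚ k * y ^ℚ (n ∸ k)))
  binomial-theorem x y n = trans (Binomial.theorem n x y)
    (sum≡sumFrom (suc n) _ (λ k → ℕ→ℚ (n C k) * (x ^ℚ k * y ^ℚ (n ∸ k))) (λ k → ×≡ℕ→ℚ* (n C toℕ k) (x ^ℚ toℕ k * y ^ℚ (n ∸ toℕ k))))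

  C-*-! : ∀ a b → ((a ℕ.+ b) C a) ℕ.* (a ! ℕ.* b !) ≡ (a ℕ.+ b) !
  C-*-! a b = begin
    ((a ℕ.+ b) C a) ℕ.* (a ! ℕ.* b !)      ≡⟨ cong (λ c → ((a ℕ.+ b) C a) ℕ.* (a ! ℕ.* c !)) (sym (ℕₚ.m+n∸m≡n a b)) ⟩
    ((a ℕ.+ b) C a) ℕ.* (a ! ℕ.* (n ∸ a) !) ≡⟨ cong (ℕ._* (a ! ℕ.* (n ∸ a) !)) (nCk≡n!/k![n-k]! {n} {a} a≤n) ⟩
    (n ! / (a ! ℕ.* (n ∸ a) !)) ℕ.* (a ! ℕ.* (n ∸ a) !) ≡⟨ m/n*n≡m (k![n∸k]!∣n! a≤n) ⟩
    n !                                     ∎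
    where
    n = a ℕ.+ b
    a≤n = ℕₚ.m≤m+n a b
    instance _ = ℕₚ._!*_!≢0 a (n ∸ a)
    open DivMod using (_/_; m/n*n≡m)

  C-*-C-sym : ∀ a b c → ((a ℕ.+ (b ℕ.+ c)) C a) ℕ.* ((b ℕ.+ c) C b) ≡ ((c ℕ.+ (b ℕ.+ a)) C c) ℕ.* ((b ℕ.+ a) C b)
  C-*-C-sym a b c = ℕₚ.*-cancelʳ-≡ _ _ (a ! ℕ.* (b ! ℕ.* c !)) {{ℕₚ.m*n≢0 (a !) (b ! ℕ.* c !) {{ℕₚ._!≢0 a}} {{ℕₚ._!*_!≢0 b c}}}} (begin
    L₁ ℕ.* L₂ ℕ.* (a ! ℕ.* (b ! ℕ.* c !))   ≡⟨ regroupˡ L₁ L₂ (a !) (b !) (c !) ⟩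
    L₁ ℕ.* (a ! ℕ.* (L₂ ℕ.* (b ! ℕ.* c !))) ≡⟨ cong (λ t → L₁ ℕ.* (a ! ℕ.* t)) (C-*-! b c) ⟩
    L₁ ℕ.* (a ! ℕ.* (b ℕ.+ c) !)            ≡⟨ C-*-! a (b ℕ.+ c) ⟩
    (a ℕ.+ (b ℕ.+ c)) !                     ≡⟨ cong _! (reverse-sum a b c) ⟩
    (c ℕ.+ (b ℕ.+ a)) !                     ≡⟨ sym (C-*-! c (b ℕ.+ a)) ⟩
    R₁ ℕ.* (c ! ℕ.* (b ℕ.+ a) !)            ≡⟨ cong (λ t → R₁ ℕ.* (c ! ℕ.* t)) (sym (C-*-! b a)) ⟩
    R₁ ℕ.* (c ! ℕ.* (R₂ ℕ.* (b ! ℕ.* a !))) ≡⟨ regroupʳ R₁ R₂ (a !) (b !) (c !) ⟩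
    R₁ ℕ.* R₂ ℕ.* (a ! ℕ.* (b ! ℕ.* c !))   ∎)
    where
    regroupˡ : ∀ L₁ L₂ x y z → L₁ ℕ.* L₂ ℕ.* (x ℕ.* (y ℕ.* z)) ≡ L₁ ℕ.* (x ℕ.* (L₂ ℕ.* (y ℕ.* z)))
    regroupˡ = solve-∀
    regroupʳ : ∀ R₁ R₂ x y z → R₁ ℕ.* (z ℕ.* (R₂ ℕ.* (y ℕ.* x))) ≡ R₁ ℕ.* R₂ ℕ.* (x ℕ.* (y ℕ.* z))
    regroupʳ = solve-∀
    reverse-sum : ∀ a b c → a ℕ.+ (b ℕ.+ c) ≡ c ℕ.+ (b ℕ.+ a)
    reverse-sum = solve-∀
    L₁ = (a ℕ.+ (b ℕ.+ c)) C a
    L₂ = (b ℕ.+ c) C b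
    R₁ = (c ℕ.+ (b ℕ.+ a)) C c
    R₂ = (b ℕ.+ a) C b

  [1+n]Cn≡1+n : ∀ n → suc n C n ≡ suc n
  [1+n]Cn≡1+n n = trans (nCk≡nC[n∸k] (ℕₚ.n≤1+n n)) (trans (cong (suc n C_) (ℕₚ.m+n∸n≡m 1 n)) (nC1≡n (suc n)))

  C-absorb : ∀ x l → x ℕ.* (x C l) ≡ l ℕ.* (x C l) ℕ.+ suc l ℕ.* (x C suc l)
  C-absorb zero zero = refl
  C-absorb zero (suc l) = sym (cong₂ ℕ._+_ (ℕₚ.*-zeroʳ (suc l)) (ℕₚ.*-zeroʳ (suc (suc l))))
  C-absorb (suc x) zero = trans (ℕₚ.*-identityʳ (suc x)) (sym (trans (ℕₚ.+-identityʳ (suc x C 1)) (nC1≡n (suc x))))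
  C-absorb (suc x) (suc l) = begin
    suc x ℕ.* (suc x C suc l)
      ≡⟨ cong (suc x ℕ.*_) (sym (nCk+nC[k+1]≡[n+1]C[k+1] x l)) ⟩
    suc x ℕ.* (x C l ℕ.+ x C suc l)
      ≡⟨ expand x (x C l) (x C suc l) ⟩
    x ℕ.* (x C l) ℕ.+ x C l ℕ.+ x ℕ.* (x C suc l) ℕ.+ x C suc l
      ≡⟨ cong₂ (λ s t → s ℕ.+ x C l ℕ.+ t ℕ.+ x C suc l) (C-absorb x l) (C-absorb x (suc l)) ⟩
    l ℕ.* (x C l) ℕ.+ suc l ℕ.* (x C suc l) ℕ.+ x C l ℕ.+ (suc l ℕ.* (x C suc l) ℕ.+ suc (suc l) ℕ.* (x C suc (suc l))) ℕ.+ x C suc l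
      ≡⟨ collect l (x C l) (x C suc l) (x C suc (suc l)) ⟩
    suc l ℕ.* (x C l ℕ.+ x C suc l) ℕ.+ suc (suc l) ℕ.* (x C suc l ℕ.+ x C suc (suc l))
      ≡⟨ cong₂ (λ s t → suc l ℕ.* s ℕ.+ suc (suc l) ℕ.* t) (nCk+nC[k+1]≡[n+1]C[k+1] x l) (nCk+nC[k+1]≡[n+1]C[k+1] x (suc l)) ⟩
    suc l ℕ.* (suc x C suc l) ℕ.+ suc (suc l) ℕ.* (suc x C suc (suc l))
      ∎
    where
    expand : ∀ x a b → suc x ℕ.* (a ℕ.+ b) ≡ x ℕ.* a ℕ.+ a ℕ.+ x ℕ.* b ℕ.+ b
    expand = solve-∀
    collect : ∀ l a b c → l ℕ.* a ℕ.+ suc l ℕ.* b ℕ.+ a ℕ.+ (suc l ℕ.* b ℕ.+ suc (suc l) ℕ.* c) ℕ.+ b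
                          ≡ suc l ℕ.* (a ℕ.+ b) ℕ.+ suc (suc l) ℕ.* (b ℕ.+ c)
    collect = solve-∀

  hockey-stick : ∀ N l → sumFrom 0 (suc N) (λ x → ℕ→ℚ (x C l)) ≡ ℕ→ℚ (suc N C suc l)
  hockey-stick zero l = trans (ℚₚ.+-identityʳ (ℕ→ℚ (0 C l)))
    (cong ℕ→ℚ (trans (sym (ℕₚ.+-identityʳ (0 C l))) (nCk+nC[k+1]≡[n+1]C[k+1] 0 l)))
  hockey-stick (suc N) l = begin
    sumFrom 0 (suc (suc N)) (λ x → ℕ→ℚ (x C l))        ≡⟨ sumFrom-last 0 (suc N) (λ x → ℕ→ℚ (x C l)) ⟩
    sumFrom 0 (suc N) (λ x → ℕ→ℚ (x C l)) + ℕ→ℚ (suc N C l) ≡⟨ cong (_+ ℕ→ℚ (suc N C l)) (hockey-stick N l) ⟩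
    ℕ→ℚ (suc N C suc l) + ℕ→ℚ (suc N C l)              ≡⟨ sym (ℕ→ℚ-+ (suc N C suc l) (suc N C l)) ⟩
    ℕ→ℚ (suc N C suc l ℕ.+ suc N C l)                  ≡⟨ cong ℕ→ℚ (trans (ℕₚ.+-comm (suc N C suc l) (suc N C l)) (nCk+nC[k+1]≡[n+1]C[k+1] (suc N) l)) ⟩
    ℕ→ℚ (suc (suc N) C suc l)                          ∎

  S₂-zero : ∀ {p l} → p < l → S₂ p l ≡ 0
  S₂-zero {zero} {suc l} _ = refl
  S₂-zero {suc p} {suc l} (s≤s p<l) =
    cong₂ ℕ._+_ (trans (cong (suc l ℕ.*_) (S₂-zero (ℕₚ.m<n⇒m<1+n p<l))) (ℕₚ.*-zeroʳ (suc l))) (S₂-zero p<l)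

  S₂-zero-column : ∀ {p} → 1 ≤ p → S₂ p 0 ≡ 0
  S₂-zero-column {suc p} _ = refl

  s₁-zero : ∀ {k i} → k < i → s₁ k i ≡ + 0
  s₁-zero {zero} {suc i} _ = refl
  s₁-zero {suc k} {suc i} (s≤s k<i) =
    cong₂ ℤ._-_ (s₁-zero k<i) (trans (cong (+ k ℤ.*_) (s₁-zero (ℕₚ.m<n⇒m<1+n k<i))) (ℤₚ.*-zeroʳ (+ k)))

  C-absorbℚ : ∀ x l → ℕ→ℚ x * ℕ→ℚ (x C l) ≡ ℕ→ℚ l * ℕ→ℚ (x C l) + ℕ→ℚ (suc l) * ℕ→ℚ (x C suc l)
  C-absorbℚ x l = begin
    ℕ→ℚ x * ℕ→ℚ (x C l)                                  ≡⟨ sym (ℕ→ℚ-* x (x C l)) ⟩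
    ℕ→ℚ (x ℕ.* (x C l))                                  ≡⟨ cong ℕ→ℚ (C-absorb x l) ⟩
    ℕ→ℚ (l ℕ.* (x C l) ℕ.+ suc l ℕ.* (x C suc l))        ≡⟨ ℕ→ℚ-+ (l ℕ.* (x C l)) (suc l ℕ.* (x C suc l)) ⟩
    ℕ→ℚ (l ℕ.* (x C l)) + ℕ→ℚ (suc l ℕ.* (x C suc l))    ≡⟨ cong₂ _+_ (ℕ→ℚ-* l (x C l)) (ℕ→ℚ-* (suc l) (x C suc l)) ⟩
    ℕ→ℚ l * ℕ→ℚ (x C l) + ℕ→ℚ (suc l) * ℕ→ℚ (x C suc l) ∎

  ^≡∑S₂ : ∀ P x → ℕ→ℚ x ^ℚ P ≡ sumFrom 0 (suc P) (λ l → ℕ→ℚ (S₂ P l) * ℕ→ℚ (l !) * ℕ→ℚ (x C l))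
  ^≡∑S₂ zero x = refl
  ^≡∑S₂ (suc P) x = begin
    X * X ^ℚ P                                              ≡⟨ cong (X *_) (^≡∑S₂ P x) ⟩
    X * sumFrom 0 (suc P) (W P)                             ≡⟨ *-distribˡ-sumFrom 0 (suc P) X (W P) ⟩
    sumFrom 0 (suc P) (λ l → X * W P l)                     ≡⟨ sumFrom-cong′ 0 (suc P) split ⟩
    sumFrom 0 (suc P) (λ l → α l + β l)                     ≡⟨ sumFrom-+ 0 (suc P) α β ⟩
    sumFrom 0 (suc P) α + sumFrom 0 (suc P) β               ≡⟨ cong (_+ sumFrom 0 (suc P) β) shift-α ⟩
    sumFrom 0 (suc P) (α ∘ suc) + sumFrom 0 (suc P) β       ≡⟨ sym (sumFrom-+ 0 (suc P) (α ∘ suc) β) ⟩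
    sumFrom 0 (suc P) (λ l → α (suc l) + β l)               ≡⟨ sumFrom-cong′ 0 (suc P) (λ l → sym (recurrence l)) ⟩
    sumFrom 0 (suc P) (W (suc P) ∘ suc)                     ≡⟨ sym (ℚₚ.+-identityˡ _) ⟩
    0ℚ + sumFrom 0 (suc P) (W (suc P) ∘ suc)                ≡⟨ cong (_+_ 0ℚ) (sym (sumFrom-suc 0 (suc P) (W (suc P)))) ⟩
    sumFrom 0 (suc (suc P)) (W (suc P))                     ∎
    where
    X = ℕ→ℚ x
    W : ℕ → ℕ → ℚ
    W P l = ℕ→ℚ (S₂ P l) * ℕ→ℚ (l !) * ℕ→ℚ (x C l)
    α β : ℕ → ℚ
    α l = ℕ→ℚ (l ℕ.* S₂ P l) * ℕ→ℚ (l !) * ℕ→ℚ (x C l)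
    β l = ℕ→ℚ (S₂ P l) * ℕ→ℚ (suc l !) * ℕ→ℚ (x C suc l)
    split : ∀ l → X * W P l ≡ α l + β l
    split l = begin
      X * (S * F * ℕ→ℚ (x C l))                                        ≡⟨ solve 4 (λ X S F b → X :* (S :* F :* b) := S :* F :* (X :* b)) refl X S F (ℕ→ℚ (x C l)) ⟩
      S * F * (X * ℕ→ℚ (x C l))                                        ≡⟨ cong (S * F *_) (C-absorbℚ x l) ⟩
      S * F * (ℕ→ℚ l * ℕ→ℚ (x C l) + ℕ→ℚ (suc l) * ℕ→ℚ (x C suc l))    ≡⟨ solve 6 (λ S F L b L′ b′ → S :* F :* (L :* b :+ L′ :* b′) := (L :* S) :* F :* b :+ S :* (L′ :* F) :* b′)
                                                                              refl S F (ℕ→ℚ l) (ℕ→ℚ (x C l)) (ℕ→ℚ (suc l)) (ℕ→ℚ (x C suc l)) ⟩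
      (ℕ→ℚ l * S) * F * ℕ→ℚ (x C l) + S * (ℕ→ℚ (suc l) * F) * ℕ→ℚ (x C suc l)
        ≡⟨ cong₂ (λ s t → s * F * ℕ→ℚ (x C l) + S * t * ℕ→ℚ (x C suc l)) (sym (ℕ→ℚ-* l (S₂ P l))) (sym (ℕ→ℚ-* (suc l) (l !))) ⟩
      α l + β l                                                        ∎
      where
      S = ℕ→ℚ (S₂ P l)
      F = ℕ→ℚ (l !)
    shift-α : sumFrom 0 (suc P) α ≡ sumFrom 0 (suc P) (α ∘ suc)
    shift-α = begin
      α 0 + sumFrom 1 P α                   ≡⟨ cong₂ _+_ (solve 2 (λ a b → con 0ℚ :* a :* b := con 0ℚ) refl 1ℚ 1ℚ) (sumFrom-suc 0 P α) ⟩
      0ℚ + sumFrom 0 P (α ∘ suc)            ≡⟨ ℚₚ.+-identityˡ _ ⟩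
      sumFrom 0 P (α ∘ suc)                 ≡⟨ sym (ℚₚ.+-identityʳ _) ⟩
      sumFrom 0 P (α ∘ suc) + 0ℚ            ≡⟨ cong (_+_ (sumFrom 0 P (α ∘ suc))) (sym α[1+P]≡0) ⟩
      sumFrom 0 P (α ∘ suc) + α (suc P)     ≡⟨ sym (sumFrom-last 0 P (α ∘ suc)) ⟩
      sumFrom 0 (suc P) (α ∘ suc)           ∎
      where
      α[1+P]≡0 : α (suc P) ≡ 0ℚ
      α[1+P]≡0 = trans (cong (λ s → ℕ→ℚ (suc P ℕ.* s) * ℕ→ℚ (suc P !) * ℕ→ℚ (x C suc P)) (S₂-zero (ℕₚ.n<1+n P)))
        (trans (cong (λ s → ℕ→ℚ s * ℕ→ℚ (suc P !) * ℕ→ℚ (x C suc P)) (ℕₚ.*-zeroʳ (suc P)))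
          (solve 2 (λ a b → con 0ℚ :* a :* b := con 0ℚ) refl (ℕ→ℚ (suc P !)) (ℕ→ℚ (x C suc P))))
    recurrence : ∀ l → W (suc P) (suc l) ≡ α (suc l) + β l
    recurrence l = trans (cong (λ s → s * ℕ→ℚ (suc l !) * ℕ→ℚ (x C suc l)) (ℕ→ℚ-+ (suc l ℕ.* S₂ P (suc l)) (S₂ P l)))
      (solve 4 (λ a b f c → (a :+ b) :* f :* c := a :* f :* c :+ b :* f :* c) refl
        (ℕ→ℚ (suc l ℕ.* S₂ P (suc l))) (ℕ→ℚ (S₂ P l)) (ℕ→ℚ (suc l !)) (ℕ→ℚ (x C suc l)))

  ∑s₁-^≡!*C : ∀ k x → sumFrom 0 (suc k) (λ i → ℤ→ℚ (s₁ k i) * ℕ→ℚ x ^ℚ i) ≡ ℕ→ℚ (k !) * ℕ→ℚ (x C k)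
  ∑s₁-^≡!*C zero x = refl
  ∑s₁-^≡!*C (suc k) x = begin
    ℤ→ℚ (+ 0) * 1ℚ + sumFrom 1 (suc k) term
      ≡⟨ trans (ℚₚ.+-identityˡ _) (sumFrom-suc 0 (suc k) term) ⟩
    sumFrom 0 (suc k) (term ∘ suc)
      ≡⟨ sumFrom-cong′ 0 (suc k) recurrence ⟩
    sumFrom 0 (suc k) (λ i → X * (s i * X ^ℚ i) - K * (s (suc i) * X ^ℚ suc i))
      ≡⟨ sym (sumFrom-- 0 (suc k) (λ i → X * (s i * X ^ℚ i)) (λ i → K * (s (suc i) * X ^ℚ suc i))) ⟩
    sumFrom 0 (suc k) (λ i → X * (s i * X ^ℚ i)) - sumFrom 0 (suc k) (λ i → K * (s (suc i) * X ^ℚ suc i))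
      ≡⟨ cong₂ _-_ (sym (*-distribˡ-sumFrom 0 (suc k) X _)) (sym (*-distribˡ-sumFrom 0 (suc k) K _)) ⟩
    X * F - K * sumFrom 0 (suc k) (λ i → s (suc i) * X ^ℚ suc i)
      ≡⟨ cong (λ t → X * F - K * t) shifted ⟩
    X * F - K * (F - s 0)
      ≡⟨ solve 4 (λ X K F s → X :* F :- K :* (F :- s) := (X :- K) :* F :+ K :* s) refl X K F (s 0) ⟩
    (X - K) * F + K * s 0
      ≡⟨ cong₂ (λ t u → (X - K) * t + u) (∑s₁-^≡!*C k x) (K*s0≡0 k) ⟩
    (X - K) * (ℕ→ℚ (k !) * ℕ→ℚ (x C k)) + 0ℚ
      ≡⟨ solve 4 (λ X K f b → (X :- K) :* (f :* b) :+ con 0ℚ := f :* (X :* b :- K :* b)) refl X K (ℕ→ℚ (k !)) (ℕ→ℚ (x C k)) ⟩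
    ℕ→ℚ (k !) * (X * ℕ→ℚ (x C k) - K * ℕ→ℚ (x C k))
      ≡⟨ cong (λ t → ℕ→ℚ (k !) * (t - K * ℕ→ℚ (x C k))) (C-absorbℚ x k) ⟩
    ℕ→ℚ (k !) * (K * ℕ→ℚ (x C k) + ℕ→ℚ (suc k) * ℕ→ℚ (x C suc k) - K * ℕ→ℚ (x C k))
      ≡⟨ solve 4 (λ f a s b → f :* (a :+ s :* b :- a) := (s :* f) :* b) refl (ℕ→ℚ (k !)) (K * ℕ→ℚ (x C k)) (ℕ→ℚ (suc k)) (ℕ→ℚ (x C suc k)) ⟩
    (ℕ→ℚ (suc k) * ℕ→ℚ (k !)) * ℕ→ℚ (x C suc k)
      ≡⟨ cong (_* ℕ→ℚ (x C suc k)) (sym (ℕ→ℚ-* (suc k) (k !))) ⟩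
    ℕ→ℚ (suc k !) * ℕ→ℚ (x C suc k)
      ∎
    where
    X = ℕ→ℚ x
    K = ℕ→ℚ k
    s : ℕ → ℚ
    s i = ℤ→ℚ (s₁ k i)
    term = λ i → ℤ→ℚ (s₁ (suc k) i) * X ^ℚ i
    F = sumFrom 0 (suc k) (λ i → s i * X ^ℚ i)
    recurrence : ∀ i → term (suc i) ≡ X * (s i * X ^ℚ i) - K * (s (suc i) * X ^ℚ suc i)
    recurrence i = trans (cong (_* X ^ℚ suc i) (trans (ℤ→ℚ-- (s₁ k i) (+ k ℤ.* s₁ k (suc i))) (cong (_-_ (s i)) (ℤ→ℚ-* (+ k) (s₁ k (suc i))))))
      (solve 5 (λ X a K b p → (a :- K :* b) :* (X :* p) := X :* (a :* p) :- K :* (b :* (X :* p))) refl X (s i) K (s (suc i)) (X ^ℚ i))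
    shifted : sumFrom 0 (suc k) (λ i → s (suc i) * X ^ℚ suc i) ≡ F - s 0
    shifted = begin
      sumFrom 0 (suc k) (λ i → s (suc i) * X ^ℚ suc i)     ≡⟨ sym (sumFrom-suc 0 (suc k) (λ i → s i * X ^ℚ i)) ⟩
      sumFrom 1 (suc k) (λ i → s i * X ^ℚ i)               ≡⟨ solve 2 (λ a b → b := (a :+ b) :- a) refl (s 0 * 1ℚ) _ ⟩
      sumFrom 0 (suc (suc k)) (λ i → s i * X ^ℚ i) - s 0 * 1ℚ
        ≡⟨ cong₂ _-_ (trans (sumFrom-last 0 (suc k) (λ i → s i * X ^ℚ i))
                        (trans (cong (λ t → F + ℤ→ℚ t * X ^ℚ suc k) (s₁-zero (ℕₚ.n<1+n k)))
                          (trans (cong (_+_ F) (ℚₚ.*-zeroˡ (X ^ℚ suc k))) (ℚₚ.+-identityʳ F))))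
                     (ℚₚ.*-identityʳ (s 0)) ⟩
      F - s 0                                              ∎
    K*s0≡0 : ∀ k → ℕ→ℚ k * ℤ→ℚ (s₁ k 0) ≡ 0ℚ
    K*s0≡0 zero = refl
    K*s0≡0 (suc k) = ℚₚ.*-zeroʳ (ℕ→ℚ (suc k))

  bernTab-stable : ∀ {m k} → k ≤ m → bernTab m k ≡ B⁺ k
  bernTab-stable {zero} {zero} _ = refl
  bernTab-stable {suc m} {k} k≤1+m = [ below , top ]′ (ℕₚ.m≤n⇒m<n∨m≡n k≤1+m)
    where
    below : k < suc m → bernTab (suc m) k ≡ B⁺ k
    below (s≤s k≤m) = trans (if-true (≤ᵇ-true k≤m)) (bernTab-stable k≤m)
    top : k ≡ suc m → bernTab (suc m) k ≡ B⁺ k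
    top refl = refl

  B⁺-suc : ∀ m → B⁺ (suc m) ≡ recipℕ (suc (suc m)) *
    (- sumRange 2 (suc (suc m)) (λ i → ℕ→ℚ (suc (suc m) C i) * sgn (suc i) * bernTab m (suc (suc m) ∸ i)))
  B⁺-suc m = if-false (≤ᵇ-false (ℕₚ.n<1+n m))

  -- The defining recurrence of B⁺ for M = m + 2, reindexed by s = i - 1.
  B⁺-recurrence : ∀ m → sumFrom 0 (suc (suc m)) (λ s → ℕ→ℚ (suc (suc m) C suc s) * sgn s * B⁺ (suc (suc m) ∸ suc s)) ≡ 0ℚ
  B⁺-recurrence m = begin
    ℕ→ℚ (M C 1) * 1ℚ * B⁺ (suc m) + sumFrom 1 (suc m) f
      ≡⟨ cong₂ (λ a b → ℕ→ℚ a * 1ℚ * B⁺ (suc m) + b) (nC1≡n M) (sumFrom-suc 0 (suc m) f) ⟩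
    ℕ→ℚ M * 1ℚ * B⁺ (suc m) + sumFrom 0 (suc m) (f ∘ suc)
      ≡⟨ cong₂ (λ a b → ℕ→ℚ M * 1ℚ * a + b) (B⁺-suc m) (sumFrom-cong 0 (suc m) (λ i _ i< → term i (ℕₚ.≤-pred i<))) ⟩
    ℕ→ℚ M * 1ℚ * (recipℕ M * (- R)) + R′
      ≡⟨ cong (λ t → ℕ→ℚ M * 1ℚ * (recipℕ M * (- t)) + R′) (trans (sumFrom-suc 1 (suc m) g) (sumFrom-suc 0 (suc m) (g ∘ suc))) ⟩
    ℕ→ℚ M * 1ℚ * (recipℕ M * (- R′)) + R′
      ≡⟨ solve 3 (λ a b x → a :* con 1ℚ :* (b :* (:- x)) :+ x := (b :* a) :* (:- x) :+ x) refl (ℕ→ℚ M) (recipℕ M) R′ ⟩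
    (recipℕ M * ℕ→ℚ M) * (- R′) + R′
      ≡⟨ cong (λ t → t * (- R′) + R′) (recipℕ-inverseˡ {M} (s≤s z≤n)) ⟩
    1ℚ * (- R′) + R′
      ≡⟨ solve 1 (λ x → con 1ℚ :* (:- x) :+ x := con 0ℚ) refl R′ ⟩
    0ℚ
      ∎
    where
    M = suc (suc m)
    f = λ s → ℕ→ℚ (M C suc s) * sgn s * B⁺ (M ∸ suc s)
    g = λ i → ℕ→ℚ (M C i) * sgn (suc i) * bernTab m (M ∸ i)
    R = sumRange 2 M g
    R′ = sumFrom 0 (suc m) (g ∘ suc ∘ suc)
    term : ∀ i → i ≤ m → f (suc i) ≡ g (suc (suc i))
    term i i≤m = cong₂ (λ σ b → ℕ→ℚ (M C suc (suc i)) * σ * b) (sym (sgn-2+ (suc i))) (sym (bernTab-stable (ℕₚ.m∸n≤m m i)))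

  -- Faulhaber's formula

  faulhaberCoeff : ℕ → ℕ → ℚ
  faulhaberCoeff j l = recipℕ (suc j) * ℕ→ℚ (suc j C (suc j ∸ suc l)) * B⁺ (suc j ∸ suc l)

  faulhaber : ℕ → ℚ → ℚ
  faulhaber j z = sumFrom 0 (suc j) (λ l → faulhaberCoeff j l * z ^ℚ suc l)

  ^-difference : ∀ z l → z ^ℚ suc l - (z - 1ℚ) ^ℚ suc l ≡
    sumFrom 0 (suc l) (λ s → ℕ→ℚ (suc l C suc s) * sgn s * z ^ℚ (l ∸ s))
  ^-difference z l = begin
    z ^ℚ suc l - (z - 1ℚ) ^ℚ suc l
      ≡⟨ cong (λ w → z ^ℚ suc l - w ^ℚ suc l) (ℚₚ.+-comm z (- 1ℚ)) ⟩
    z ^ℚ suc l - (- 1ℚ + z) ^ℚ suc l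
      ≡⟨ cong (_-_ (z ^ℚ suc l)) (binomial-theorem (- 1ℚ) z (suc l)) ⟩
    z ^ℚ suc l - (1ℚ * (1ℚ * z ^ℚ suc l) + sumFrom 1 (suc l) t)
      ≡⟨ cong (λ w → z ^ℚ suc l - (1ℚ * (1ℚ * z ^ℚ suc l) + w)) (sumFrom-suc 0 (suc l) t) ⟩
    z ^ℚ suc l - (1ℚ * (1ℚ * z ^ℚ suc l) + sumFrom 0 (suc l) (t ∘ suc))
      ≡⟨ solve 2 (λ p y → p :- (con 1ℚ :* (con 1ℚ :* p) :+ y) := :- y) refl (z ^ℚ suc l) _ ⟩
    - sumFrom 0 (suc l) (t ∘ suc)
      ≡⟨ neg-distrib-sumFrom 0 (suc l) (t ∘ suc) ⟩
    sumFrom 0 (suc l) (λ s → - t (suc s))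
      ≡⟨ sumFrom-cong′ 0 (suc l) (λ s → trans (cong (λ w → - (ℕ→ℚ (suc l C suc s) * (w * z ^ℚ (l ∸ s)))) (sym (sgn≡-1^ (suc s))))
           (solve 3 (λ b g q → :- (b :* ((:- g) :* q)) := b :* g :* q) refl (ℕ→ℚ (suc l C suc s)) (sgn s) (z ^ℚ (l ∸ s)))) ⟩
    sumFrom 0 (suc l) (λ s → ℕ→ℚ (suc l C suc s) * sgn s * z ^ℚ (l ∸ s))
      ∎
    where
    t = λ s → ℕ→ℚ (suc l C s) * ((- 1ℚ) ^ℚ s * z ^ℚ (suc l ∸ s))

  C-*-C-shift : ∀ d s e → s ≤ e →
    (suc (d ℕ.+ e) C (e ∸ s)) ℕ.* (suc (d ℕ.+ s) C suc s) ≡ (suc (d ℕ.+ e) C d) ℕ.* (suc e C suc s)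
  C-*-C-shift d s e s≤e with ℕₚ.m≤n⇒∃[o]m+o≡n s≤e
  ... | u , refl = begin
    (suc (d ℕ.+ (s ℕ.+ u)) C (s ℕ.+ u ∸ s)) ℕ.* (suc (d ℕ.+ s) C suc s)
      ≡⟨ cong₂ (λ a b → (suc (d ℕ.+ (s ℕ.+ u)) C a) ℕ.* (b C suc s)) (ℕₚ.m+n∸m≡n s u) (cong suc (ℕₚ.+-comm d s)) ⟩
    (suc (d ℕ.+ (s ℕ.+ u)) C u) ℕ.* ((suc s ℕ.+ d) C suc s)
      ≡⟨ cong (λ a → (a C u) ℕ.* ((suc s ℕ.+ d) C suc s)) (reassoc d s u) ⟩
    ((u ℕ.+ (suc s ℕ.+ d)) C u) ℕ.* ((suc s ℕ.+ d) C suc s)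
      ≡⟨ C-*-C-sym u (suc s) d ⟩
    ((d ℕ.+ (suc s ℕ.+ u)) C d) ℕ.* ((suc s ℕ.+ u) C suc s)
      ≡⟨ cong (λ a → (a C d) ℕ.* ((suc s ℕ.+ u) C suc s)) (ℕₚ.+-suc d (s ℕ.+ u)) ⟩
    (suc (d ℕ.+ (s ℕ.+ u)) C d) ℕ.* (suc (s ℕ.+ u) C suc s)
      ∎
    where
    reassoc : ∀ d s u → suc (d ℕ.+ (s ℕ.+ u)) ≡ u ℕ.+ (suc s ℕ.+ d)
    reassoc = solve-∀

  -- After collecting powers of z, the coefficient of z ^ d in faulhaber j z - faulhaber j (z - 1)
  -- is 1/(j+1) C(j+1, d) times a Bernoulli recurrence sum, which vanishes unless d = j.
  faulhaber-diff-coeff : ∀ d e z →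
    sumFrom 0 (suc e) (λ s → faulhaberCoeff (d ℕ.+ e) (d ℕ.+ s) * (ℕ→ℚ (suc (d ℕ.+ s) C suc s) * sgn s * z ^ℚ d))
    ≡ (if e ≡ᵇ 0 then z ^ℚ d else 0ℚ)
  faulhaber-diff-coeff d e z = begin
    sumFrom 0 (suc e) (λ s → faulhaberCoeff (d ℕ.+ e) (d ℕ.+ s) * (ℕ→ℚ (suc (d ℕ.+ s) C suc s) * sgn s * z ^ℚ d))
      ≡⟨ sumFrom-cong 0 (suc e) (λ s _ s< → regroup s (ℕₚ.≤-pred s<)) ⟩
    sumFrom 0 (suc e) (λ s → K * bernoulliTerm e s)
      ≡⟨ sym (*-distribˡ-sumFrom 0 (suc e) K (bernoulliTerm e)) ⟩
    K * sumFrom 0 (suc e) (bernoulliTerm e)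
      ≡⟨ collapse e ⟩
    (if e ≡ᵇ 0 then z ^ℚ d else 0ℚ)
      ∎
    where
    J = suc (d ℕ.+ e)
    K = recipℕ J * ℕ→ℚ (J C d) * z ^ℚ d
    bernoulliTerm : ℕ → ℕ → ℚ
    bernoulliTerm e s = ℕ→ℚ (suc e C suc s) * sgn s * B⁺ (suc e ∸ suc s)
    regroup : ∀ s → s ≤ e → faulhaberCoeff (d ℕ.+ e) (d ℕ.+ s) * (ℕ→ℚ (suc (d ℕ.+ s) C suc s) * sgn s * z ^ℚ d)
                            ≡ K * bernoulliTerm e s
    regroup s s≤e = begin
      recipℕ J * ℕ→ℚ (J C (J ∸ suc (d ℕ.+ s))) * B⁺ (J ∸ suc (d ℕ.+ s)) * (ℕ→ℚ (suc (d ℕ.+ s) C suc s) * sgn s * z ^ℚ d)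
        ≡⟨ cong (λ w → recipℕ J * ℕ→ℚ (J C w) * B⁺ w * (ℕ→ℚ (suc (d ℕ.+ s) C suc s) * sgn s * z ^ℚ d)) (ℕₚ.[m+n]∸[m+o]≡n∸o d e s) ⟩
      recipℕ J * ℕ→ℚ (J C (e ∸ s)) * B⁺ (e ∸ s) * (ℕ→ℚ (suc (d ℕ.+ s) C suc s) * sgn s * z ^ℚ d)
        ≡⟨ solve 6 (λ r a b c g p → r :* a :* b :* (c :* g :* p) := r :* (a :* c) :* b :* g :* p) refl
             (recipℕ J) (ℕ→ℚ (J C (e ∸ s))) (B⁺ (e ∸ s)) (ℕ→ℚ (suc (d ℕ.+ s) C suc s)) (sgn s) (z ^ℚ d) ⟩
      recipℕ J * (ℕ→ℚ (J C (e ∸ s)) * ℕ→ℚ (suc (d ℕ.+ s) C suc s)) * B⁺ (e ∸ s) * sgn s * z ^ℚ d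
        ≡⟨ cong (λ w → recipℕ J * w * B⁺ (e ∸ s) * sgn s * z ^ℚ d)
             (trans (sym (ℕ→ℚ-* (J C (e ∸ s)) (suc (d ℕ.+ s) C suc s)))
               (trans (cong ℕ→ℚ (C-*-C-shift d s e s≤e)) (ℕ→ℚ-* (J C d) (suc e C suc s)))) ⟩
      recipℕ J * (ℕ→ℚ (J C d) * ℕ→ℚ (suc e C suc s)) * B⁺ (e ∸ s) * sgn s * z ^ℚ d
        ≡⟨ solve 6 (λ r a c b g p → r :* (a :* c) :* b :* g :* p := r :* a :* p :* (c :* g :* b)) refl
             (recipℕ J) (ℕ→ℚ (J C d)) (ℕ→ℚ (suc e C suc s)) (B⁺ (e ∸ s)) (sgn s) (z ^ℚ d) ⟩
      K * bernoulliTerm e s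
        ∎
    collapse : ∀ e → (recipℕ (suc (d ℕ.+ e)) * ℕ→ℚ (suc (d ℕ.+ e) C d) * z ^ℚ d) * sumFrom 0 (suc e) (bernoulliTerm e)
                     ≡ (if e ≡ᵇ 0 then z ^ℚ d else 0ℚ)
    collapse zero = begin
      (recipℕ (suc (d ℕ.+ 0)) * ℕ→ℚ (suc (d ℕ.+ 0) C d) * z ^ℚ d) * (1ℚ * 1ℚ * 1ℚ + 0ℚ)
        ≡⟨ cong (λ n → (recipℕ (suc n) * ℕ→ℚ (suc n C d) * z ^ℚ d) * (1ℚ * 1ℚ * 1ℚ + 0ℚ)) (ℕₚ.+-identityʳ d) ⟩
      (recipℕ (suc d) * ℕ→ℚ (suc d C d) * z ^ℚ d) * (1ℚ * 1ℚ * 1ℚ + 0ℚ)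
        ≡⟨ cong (λ w → (recipℕ (suc d) * ℕ→ℚ w * z ^ℚ d) * (1ℚ * 1ℚ * 1ℚ + 0ℚ)) ([1+n]Cn≡1+n d) ⟩
      (recipℕ (suc d) * ℕ→ℚ (suc d) * z ^ℚ d) * (1ℚ * 1ℚ * 1ℚ + 0ℚ)
        ≡⟨ cong (λ w → (w * z ^ℚ d) * (1ℚ * 1ℚ * 1ℚ + 0ℚ)) (recipℕ-inverseˡ {suc d} (s≤s z≤n)) ⟩
      (1ℚ * z ^ℚ d) * (1ℚ * 1ℚ * 1ℚ + 0ℚ)
        ≡⟨ solve 1 (λ p → (con 1ℚ :* p) :* (con 1ℚ :* con 1ℚ :* con 1ℚ :+ con 0ℚ) := p) refl (z ^ℚ d) ⟩
      z ^ℚ d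
        ∎
    collapse (suc m) = trans (cong (K′ *_) (B⁺-recurrence m)) (ℚₚ.*-zeroʳ K′)
      where K′ = recipℕ (suc (d ℕ.+ suc m)) * ℕ→ℚ (suc (d ℕ.+ suc m) C d) * z ^ℚ d

  faulhaber-difference : ∀ j z → faulhaber j z - faulhaber j (z - 1ℚ) ≡ z ^ℚ j
  faulhaber-difference j z = begin
    faulhaber j z - faulhaber j (z - 1ℚ)
      ≡⟨ sumFrom-- 0 (suc j) (λ l → faulhaberCoeff j l * z ^ℚ suc l) (λ l → faulhaberCoeff j l * (z - 1ℚ) ^ℚ suc l) ⟩
    sumFrom 0 (suc j) (λ l → faulhaberCoeff j l * z ^ℚ suc l - faulhaberCoeff j l * (z - 1ℚ) ^ℚ suc l)
      ≡⟨ sumFrom-cong′ 0 (suc j) expand ⟩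
    sumFrom 0 (suc j) (λ l → sumFrom 0 (suc l) (λ s → term s (l ∸ s)))
      ≡⟨ sumFrom-antidiagonal (suc j) term ⟩
    sumFrom 0 (suc j) (λ d → sumFrom 0 (suc j ∸ d) (λ s → term s d))
      ≡⟨ sumFrom-cong 0 (suc j) (λ d _ d< → coefficient d (ℕₚ.≤-pred d<)) ⟩
    sumFrom 0 (suc j) (λ d → if j ≡ᵇ d then z ^ℚ d else 0ℚ)
      ≡⟨ sumFrom-indicator 0 (suc j) j (z ^ℚ_) z≤n (ℕₚ.n<1+n j) ⟩
    z ^ℚ j
      ∎
    where
    term : ℕ → ℕ → ℚ
    term s d = faulhaberCoeff j (d ℕ.+ s) * (ℕ→ℚ (suc (d ℕ.+ s) C suc s) * sgn s * z ^ℚ d)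
    expand : ∀ l → faulhaberCoeff j l * z ^ℚ suc l - faulhaberCoeff j l * (z - 1ℚ) ^ℚ suc l
                   ≡ sumFrom 0 (suc l) (λ s → term s (l ∸ s))
    expand l = begin
      faulhaberCoeff j l * z ^ℚ suc l - faulhaberCoeff j l * (z - 1ℚ) ^ℚ suc l
        ≡⟨ solve 3 (λ c p q → c :* p :- c :* q := c :* (p :- q)) refl (faulhaberCoeff j l) (z ^ℚ suc l) ((z - 1ℚ) ^ℚ suc l) ⟩
      faulhaberCoeff j l * (z ^ℚ suc l - (z - 1ℚ) ^ℚ suc l)
        ≡⟨ cong (faulhaberCoeff j l *_) (^-difference z l) ⟩
      faulhaberCoeff j l * sumFrom 0 (suc l) (λ s → ℕ→ℚ (suc l C suc s) * sgn s * z ^ℚ (l ∸ s))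
        ≡⟨ *-distribˡ-sumFrom 0 (suc l) (faulhaberCoeff j l) _ ⟩
      sumFrom 0 (suc l) (λ s → faulhaberCoeff j l * (ℕ→ℚ (suc l C suc s) * sgn s * z ^ℚ (l ∸ s)))
        ≡⟨ sumFrom-cong 0 (suc l) (λ s _ s< → cong (λ w → faulhaberCoeff j w * (ℕ→ℚ (suc w C suc s) * sgn s * z ^ℚ (l ∸ s)))
              (sym (ℕₚ.m∸n+n≡m (ℕₚ.≤-pred s<)))) ⟩
      sumFrom 0 (suc l) (λ s → term s (l ∸ s))
        ∎
    coefficient : ∀ d → d ≤ j → sumFrom 0 (suc j ∸ d) (λ s → term s d) ≡ (if j ≡ᵇ d then z ^ℚ d else 0ℚ)
    coefficient d d≤j = subst (λ j′ → sumFrom 0 (suc j′ ∸ d) (λ s → term′ j′ s d) ≡ (if j′ ≡ᵇ d then z ^ℚ d else 0ℚ))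
                               (ℕₚ.m+[n∸m]≡n d≤j) (shifted (j ∸ d))
      where
      term′ : ℕ → ℕ → ℕ → ℚ
      term′ j′ s d = faulhaberCoeff j′ (d ℕ.+ s) * (ℕ→ℚ (suc (d ℕ.+ s) C suc s) * sgn s * z ^ℚ d)
      shifted : ∀ e → sumFrom 0 (suc (d ℕ.+ e) ∸ d) (λ s → term′ (d ℕ.+ e) s d) ≡ (if d ℕ.+ e ≡ᵇ d then z ^ℚ d else 0ℚ)
      shifted e = begin
        sumFrom 0 (suc (d ℕ.+ e) ∸ d) (λ s → term′ (d ℕ.+ e) s d)
          ≡⟨ cong (λ w → sumFrom 0 w (λ s → term′ (d ℕ.+ e) s d)) (trans (ℕₚ.+-∸-assoc 1 (ℕₚ.m≤m+n d e)) (cong suc (ℕₚ.m+n∸m≡n d e))) ⟩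
        sumFrom 0 (suc e) (λ s → term′ (d ℕ.+ e) s d)
          ≡⟨ faulhaber-diff-coeff d e z ⟩
        (if e ≡ᵇ 0 then z ^ℚ d else 0ℚ)
          ≡⟨ cong (if_then z ^ℚ d else 0ℚ) (sym (m+n≡ᵇm d e)) ⟩
        (if d ℕ.+ e ≡ᵇ d then z ^ℚ d else 0ℚ)
          ∎

  faulhaber-sum : ∀ j N → sumFrom 1 N (λ k → ℕ→ℚ k ^ℚ j) ≡ faulhaber j (ℕ→ℚ N)
  faulhaber-sum j zero = sym (sumFrom-zero 0 (suc j) (λ l _ _ → trans (cong (faulhaberCoeff j l *_) (0^suc l)) (ℚₚ.*-zeroʳ (faulhaberCoeff j l))))
  faulhaber-sum j (suc N) = begin
    sumFrom 1 (suc N) (λ k → ℕ→ℚ k ^ℚ j)            ≡⟨ sumFrom-last 1 N (λ k → ℕ→ℚ k ^ℚ j) ⟩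
    sumFrom 1 N (λ k → ℕ→ℚ k ^ℚ j) + Z ^ℚ j          ≡⟨ cong (_+ Z ^ℚ j) (faulhaber-sum j N) ⟩
    faulhaber j (ℕ→ℚ N) + Z ^ℚ j                     ≡⟨ cong (λ w → faulhaber j w + Z ^ℚ j) N≡Z-1 ⟩
    faulhaber j (Z - 1ℚ) + Z ^ℚ j                    ≡⟨ cong (_+_ (faulhaber j (Z - 1ℚ))) (sym (faulhaber-difference j Z)) ⟩
    faulhaber j (Z - 1ℚ) + (faulhaber j Z - faulhaber j (Z - 1ℚ))
                                                     ≡⟨ solve 2 (λ a b → a :+ (b :- a) := b) refl (faulhaber j (Z - 1ℚ)) (faulhaber j Z) ⟩
    faulhaber j Z                                    ∎
    where
    Z = ℕ→ℚ (suc N)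
    N≡Z-1 : ℕ→ℚ N ≡ Z - 1ℚ
    N≡Z-1 = trans (solve 1 (λ x → x := (con 1ℚ :+ x) :- con 1ℚ) refl (ℕ→ℚ N)) (cong (_- 1ℚ) (sym (ℕ→ℚ-+ 1 N)))

  faulhaber-range : ∀ j N i → 1 ≤ i → i ≤ suc N →
    faulhaber j (ℕ→ℚ N) - faulhaber j (ℕ→ℚ i - 1ℚ) ≡ sumRange i N (λ k → ℕ→ℚ k ^ℚ j)
  faulhaber-range j N (suc i) _ (s≤s i≤N) = begin
    faulhaber j (ℕ→ℚ N) - faulhaber j (ℕ→ℚ (suc i) - 1ℚ)
      ≡⟨ cong₂ (λ a b → a - faulhaber j b) (sym (faulhaber-sum j N)) (sym (ℕ→ℚ-∸ {suc i} {1} (s≤s z≤n))) ⟩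
    sumFrom 1 N f - faulhaber j (ℕ→ℚ i)
      ≡⟨ cong (_-_ (sumFrom 1 N f)) (sym (faulhaber-sum j i)) ⟩
    sumFrom 1 N f - sumFrom 1 i f
      ≡⟨ cong (λ l → sumFrom 1 l f - sumFrom 1 i f) (sym (ℕₚ.m+[n∸m]≡n i≤N)) ⟩
    sumFrom 1 (i ℕ.+ (N ∸ i)) f - sumFrom 1 i f
      ≡⟨ cong (_- sumFrom 1 i f) (sumFrom-split 1 i (N ∸ i) f) ⟩
    sumFrom 1 i f + sumFrom (suc i) (N ∸ i) f - sumFrom 1 i f
      ≡⟨ solve 2 (λ p q → p :+ q :- p := q) refl (sumFrom 1 i f) (sumFrom (suc i) (N ∸ i) f) ⟩
    sumFrom (suc i) (N ∸ i) f
      ∎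
    where
    f = λ k → ℕ→ℚ k ^ℚ j

  -- Coefficient of Y ^ s in faulhaber j (Y - 1); the numbers D(r,m,j,y) of the â-recursion are these
  -- coefficients (see D≡shiftedFaulhaberCoeff).
  shiftedFaulhaberCoeff : ℕ → ℕ → ℚ
  shiftedFaulhaberCoeff j s = sumFrom 0 (suc j) (λ l → faulhaberCoeff j l * (ℕ→ℚ (suc l C s) * sgn (suc l ∸ s)))

  shiftedFaulhaberCoeff-vanishes : ∀ {j s} → suc j < s → shiftedFaulhaberCoeff j s ≡ 0ℚ
  shiftedFaulhaberCoeff-vanishes {j} {s} 1+j<s = sumFrom-zero 0 (suc j) (λ l _ l<1+j → trans
    (cong (λ c → faulhaberCoeff j l * (ℕ→ℚ c * sgn (suc l ∸ s))) (k>n⇒nCk≡0 (ℕₚ.≤-<-trans l<1+j 1+j<s)))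
    (solve 2 (λ c g → c :* (con 0ℚ :* g) := con 0ℚ) refl (faulhaberCoeff j l) (sgn (suc l ∸ s))))

  shiftedFaulhaberCoeff-top : ∀ j → shiftedFaulhaberCoeff j (suc j) ≡ recipℕ (suc j)
  shiftedFaulhaberCoeff-top j = begin
    shiftedFaulhaberCoeff j (suc j)
      ≡⟨ sumFrom-single 0 (suc j) j term z≤n (ℕₚ.n<1+n j) (λ l _ l<1+j l≢j → below l (ℕₚ.≤∧≢⇒< (ℕₚ.≤-pred l<1+j) l≢j)) ⟩
    faulhaberCoeff j j * (ℕ→ℚ (suc j C suc j) * sgn (suc j ∸ suc j))
      ≡⟨ cong₂ (λ c σ → recipℕ (suc j) * ℕ→ℚ (suc j C σ) * B⁺ σ * (ℕ→ℚ c * sgn σ)) (nCn≡1 (suc j)) (ℕₚ.n∸n≡0 j) ⟩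
    recipℕ (suc j) * 1ℚ * 1ℚ * (1ℚ * 1ℚ)
      ≡⟨ solve 1 (λ r → r :* con 1ℚ :* con 1ℚ :* (con 1ℚ :* con 1ℚ) := r) refl (recipℕ (suc j)) ⟩
    recipℕ (suc j)
      ∎
    where
    term = λ l → faulhaberCoeff j l * (ℕ→ℚ (suc l C suc j) * sgn (suc l ∸ suc j))
    below : ∀ l → l < j → term l ≡ 0ℚ
    below l l<j = trans (cong (λ c → faulhaberCoeff j l * (ℕ→ℚ c * sgn (suc l ∸ suc j))) (k>n⇒nCk≡0 (s≤s l<j)))
      (solve 2 (λ c g → c :* (con 0ℚ :* g) := con 0ℚ) refl (faulhaberCoeff j l) (sgn (suc l ∸ suc j)))

  faulhaber-shift : ∀ {j R} Y → j < R → faulhaber j (Y - 1ℚ) ≡ sumFrom 0 (suc R) (λ s → shiftedFaulhaberCoeff j s * Y ^ℚ s)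
  faulhaber-shift {j} {R} Y j<R = begin
    faulhaber j (Y - 1ℚ)
      ≡⟨ sumFrom-cong 0 (suc j) (λ l _ l<1+j → expand l (ℕₚ.≤-trans l<1+j j<R)) ⟩
    sumFrom 0 (suc j) (λ l → sumFrom 0 (suc R) (λ s → term l s * Y ^ℚ s))
      ≡⟨ sumFrom-comm 0 (suc j) 0 (suc R) (λ l s → term l s * Y ^ℚ s) ⟩
    sumFrom 0 (suc R) (λ s → sumFrom 0 (suc j) (λ l → term l s * Y ^ℚ s))
      ≡⟨ sumFrom-cong′ 0 (suc R) (λ s → sym (*-distribʳ-sumFrom 0 (suc j) (Y ^ℚ s) (λ l → term l s))) ⟩
    sumFrom 0 (suc R) (λ s → shiftedFaulhaberCoeff j s * Y ^ℚ s)
      ∎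
    where
    term = λ l s → faulhaberCoeff j l * (ℕ→ℚ (suc l C s) * sgn (suc l ∸ s))
    expand : ∀ l → l < R → faulhaberCoeff j l * (Y - 1ℚ) ^ℚ suc l ≡ sumFrom 0 (suc R) (λ s → term l s * Y ^ℚ s)
    expand l l<R = begin
      faulhaberCoeff j l * (Y + - 1ℚ) ^ℚ suc l
        ≡⟨ cong (faulhaberCoeff j l *_) (binomial-theorem Y (- 1ℚ) (suc l)) ⟩
      faulhaberCoeff j l * sumFrom 0 (suc (suc l)) (λ s → ℕ→ℚ (suc l C s) * (Y ^ℚ s * (- 1ℚ) ^ℚ (suc l ∸ s)))
        ≡⟨ *-distribˡ-sumFrom 0 (suc (suc l)) (faulhaberCoeff j l) _ ⟩
      sumFrom 0 (suc (suc l)) (λ s → faulhaberCoeff j l * (ℕ→ℚ (suc l C s) * (Y ^ℚ s * (- 1ℚ) ^ℚ (suc l ∸ s))))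
        ≡⟨ sumFrom-cong′ 0 (suc (suc l)) (λ s → trans (cong (λ w → faulhaberCoeff j l * (ℕ→ℚ (suc l C s) * (Y ^ℚ s * w))) (sym (sgn≡-1^ (suc l ∸ s))))
             (solve 4 (λ c b p g → c :* (b :* (p :* g)) := c :* (b :* g) :* p) refl (faulhaberCoeff j l) (ℕ→ℚ (suc l C s)) (Y ^ℚ s) (sgn (suc l ∸ s)))) ⟩
      sumFrom 0 (suc (suc l)) (λ s → term l s * Y ^ℚ s)
        ≡⟨ sym (trans (cong (λ n → sumFrom 0 n (λ s → term l s * Y ^ℚ s)) (sym (ℕₚ.m+[n∸m]≡n (s≤s l<R))))
                      (sumFrom-pad 0 (suc (suc l)) (suc R ∸ suc (suc l)) (λ s → term l s * Y ^ℚ s) (λ s l+2≤s _ → beyond s l+2≤s))) ⟩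
      sumFrom 0 (suc R) (λ s → term l s * Y ^ℚ s)
        ∎
      where
      beyond : ∀ s → suc (suc l) ≤ s → term l s * Y ^ℚ s ≡ 0ℚ
      beyond s l+2≤s = trans (cong (λ c → faulhaberCoeff j l * (ℕ→ℚ c * sgn (suc l ∸ s)) * Y ^ℚ s) (k>n⇒nCk≡0 l+2≤s))
        (solve 3 (λ c g p → c :* (con 0ℚ :* g) :* p := con 0ℚ) refl (faulhaberCoeff j l) (sgn (suc l ∸ s)) (Y ^ℚ s))

  -- The sign (-1)^(1+ℓ-m+y) of D, written with m = v + s, y = v.
  sgn-parity : ∀ l v s → s ≤ suc l → sgn (1 ℕ.+ l ℕ.+ (v ℕ.+ s) ℕ.+ v) ≡ sgn (suc l ∸ s)
  sgn-parity l v s s≤1+l with ℕₚ.m≤n⇒∃[o]m+o≡n s≤1+l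
  ... | u , s+u≡1+l = begin
    sgn (suc l ℕ.+ (v ℕ.+ s) ℕ.+ v)              ≡⟨ cong (λ w → sgn (w ℕ.+ (v ℕ.+ s) ℕ.+ v)) (sym s+u≡1+l) ⟩
    sgn (s ℕ.+ u ℕ.+ (v ℕ.+ s) ℕ.+ v)            ≡⟨ cong sgn (regroup s u v) ⟩
    sgn (u ℕ.+ ((s ℕ.+ s) ℕ.+ (v ℕ.+ v)))         ≡⟨ trans (sgn-+ u _) (cong (sgn u *_) (trans (sgn-+ (s ℕ.+ s) (v ℕ.+ v))
                                                       (cong₂ _*_ (sgn-+-self s) (sgn-+-self v)))) ⟩
    sgn u * (1ℚ * 1ℚ)                             ≡⟨ ℚₚ.*-identityʳ (sgn u) ⟩
    sgn u                                         ≡⟨ cong sgn (sym (trans (cong (_∸ s) (sym s+u≡1+l)) (ℕₚ.m+n∸m≡n s u))) ⟩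
    sgn (suc l ∸ s)                               ∎
    where
    regroup : ∀ s u v → s ℕ.+ u ℕ.+ (v ℕ.+ s) ℕ.+ v ≡ u ℕ.+ ((s ℕ.+ s) ℕ.+ (v ℕ.+ v))
    regroup = solve-∀

  D≡shiftedFaulhaberCoeff : ∀ {r m j v} → v ≤ m → D r m j v ≡ shiftedFaulhaberCoeff j (m ∸ v)
  D≡shiftedFaulhaberCoeff {r} {m} {j} {v} v≤m =
    subst (λ n → D r n j v ≡ shiftedFaulhaberCoeff j (m ∸ v)) (ℕₚ.m+[n∸m]≡n v≤m) (shifted (m ∸ v))
    where
    shifted : ∀ s → D r (v ℕ.+ s) j v ≡ shiftedFaulhaberCoeff j s
    shifted s = begin
      D r (v ℕ.+ s) j v
        ≡⟨ sumRange-embed (v ℕ.+ s ∸ v ∸ 1) j (suc j) dTerm term (ℕₚ.n<1+n j) (λ l lo≤l _ → inside l lo≤l) outside ⟩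
      shiftedFaulhaberCoeff j s
        ∎
      where
      v+s∸v≡s : v ℕ.+ s ∸ v ≡ s
      v+s∸v≡s = ℕₚ.m+n∸m≡n v s
      lo≡ : v ℕ.+ s ∸ v ∸ 1 ≡ s ∸ 1
      lo≡ = cong (_∸ 1) v+s∸v≡s
      1+l<s : ∀ {l} s → l < s ∸ 1 → suc l < s
      1+l<s (suc s) l<s = s≤s l<s
      term = λ l → faulhaberCoeff j l * (ℕ→ℚ (suc l C s) * sgn (suc l ∸ s))
      dTerm = λ l → recipℕ (suc j) * ℕ→ℚ (suc j C (j ∸ l)) * B⁺ (j ∸ l) * ℕ→ℚ (suc l C (v ℕ.+ s ∸ v)) * sgn (1 ℕ.+ l ℕ.+ (v ℕ.+ s) ℕ.+ v)
      inside : ∀ l → v ℕ.+ s ∸ v ∸ 1 ≤ l → term l ≡ dTerm l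
      inside l lo≤l = begin
        faulhaberCoeff j l * (ℕ→ℚ (suc l C s) * sgn (suc l ∸ s))
          ≡⟨ cong₂ (λ c σ → faulhaberCoeff j l * (ℕ→ℚ (suc l C c) * σ)) (sym v+s∸v≡s) (sym (sgn-parity l v s s≤1+l)) ⟩
        faulhaberCoeff j l * (ℕ→ℚ (suc l C (v ℕ.+ s ∸ v)) * sgn (1 ℕ.+ l ℕ.+ (v ℕ.+ s) ℕ.+ v))
          ≡⟨ solve 5 (λ r c b p q → r :* c :* b :* (p :* q) := r :* c :* b :* p :* q) refl
               (recipℕ (suc j)) (ℕ→ℚ (suc j C (j ∸ l))) (B⁺ (j ∸ l)) (ℕ→ℚ (suc l C (v ℕ.+ s ∸ v))) (sgn (1 ℕ.+ l ℕ.+ (v ℕ.+ s) ℕ.+ v)) ⟩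
        recipℕ (suc j) * ℕ→ℚ (suc j C (j ∸ l)) * B⁺ (j ∸ l) * ℕ→ℚ (suc l C (v ℕ.+ s ∸ v)) * sgn (1 ℕ.+ l ℕ.+ (v ℕ.+ s) ℕ.+ v)
          ∎
        where
        s≤1+l : s ≤ suc l
        s≤1+l = ℕₚ.≤-trans (ℕₚ.m≤n+m∸n s 1) (s≤s (subst (_≤ l) lo≡ lo≤l))
      outside : ∀ l → l < suc j → l < v ℕ.+ s ∸ v ∸ 1 ⊎ j < l → term l ≡ 0ℚ
      outside l _ (inj₁ l<lo) = trans (cong (λ c → faulhaberCoeff j l * (ℕ→ℚ c * sgn (suc l ∸ s))) (k>n⇒nCk≡0 (1+l<s s (subst (l <_) lo≡ l<lo))))
         (solve 2 (λ c g → c :* (con 0ℚ :* g) := con 0ℚ) refl (faulhaberCoeff j l) (sgn (suc l ∸ s)))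
      outside l l<1+j (inj₂ j<l) = contradiction l<1+j (ℕₚ.<⇒≱ (s≤s j<l))

  â-vanishes : ∀ {r m j} → r ≤ m ℕ.+ j → â r m j ≡ 0ℚ
  â-vanishes {zero} _ = refl
  â-vanishes {suc zero} {zero} {zero} ()
  â-vanishes {suc zero} {zero} {suc j} _ = refl
  â-vanishes {suc zero} {suc m} _ = refl
  â-vanishes {suc (suc r)} {m} {zero} r+2≤m+0 =
    trans (if-false (≡ᵇ-false (λ m≡r+1 → ℕₚ.<-irrefl (sym m≡r+1) r+2≤m))) (if-false (≤ᵇ-false (ℕₚ.m≤n⇒m≤1+n r+2≤m)))
    where
    r+2≤m : suc (suc r) ≤ m
    r+2≤m = subst (suc (suc r) ≤_) (ℕₚ.+-identityʳ m) r+2≤m+0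
  â-vanishes {suc (suc r)} {m} {suc l} r+2≤m+1+l = case (m ℕₚ.<? suc r)
    where
    case : Dec (m < suc r) → âStep (suc r) (â (suc r)) m (suc l) ≡ 0ℚ
    case (yes m<r+1) = if-false (trans (cong (_∧ (suc l ≤ᵇ suc r ∸ m)) (≤ᵇ-true m<r+1)) (≤ᵇ-false r+1∸m<1+l))
      where
      r+1∸m<1+l : suc r ∸ m < suc l
      r+1∸m<1+l = s≤s (ℕₚ.m≤n+o⇒m∸n≤o (suc r) m (ℕₚ.≤-pred (subst (suc (suc r) ≤_) (ℕₚ.+-suc m l) r+2≤m+1+l)))
    case (no m≮r+1) = if-false (cong (_∧ (suc l ≤ᵇ suc r ∸ m)) (≤ᵇ-false (s≤s (ℕₚ.≮⇒≥ m≮r+1))))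

  â*-vanishes : ∀ {r m j} c → r ≤ m ℕ.+ j → â r m j * c ≡ 0ℚ
  â*-vanishes {r} {m} {j} c r≤m+j = trans (cong (_* c) (â-vanishes {r} {m} {j} r≤m+j)) (ℚₚ.*-zeroˡ c)

  ∸<⇒<+ : ∀ {r m j} → r ∸ m < j → r < m ℕ.+ j
  ∸<⇒<+ {r} {m} {j} r∸m<j = ℕₚ.≤-<-trans (ℕₚ.m≤n+m∸n r m) (ℕₚ.+-monoʳ-< m r∸m<j)

  xCoeffTerm : ℕ → ℕ → ℕ → ℕ → ℚ
  xCoeffTerm R m l j = if l ≤ᵇ j then â R m j * faulhaberCoeff j l else 0ℚ

  xCoeffTerm-vanishes : ∀ R m l j → (l ≤ j → R ≤ m ℕ.+ j) → xCoeffTerm R m l j ≡ 0ℚ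
  xCoeffTerm-vanishes R m l j vanish = case (l ℕₚ.≤? j)
    where
    case : Dec (l ≤ j) → xCoeffTerm R m l j ≡ 0ℚ
    case (yes l≤j) = trans (if-true (≤ᵇ-true l≤j)) (â*-vanishes {R} {m} {j} (faulhaberCoeff j l) (vanish l≤j))
    case (no l≰j) = if-false (≤ᵇ-false (ℕₚ.≰⇒> l≰j))

  âStep-suc : ∀ {r} m l → m < suc r → âStep (suc r) (â (suc r)) m (suc l) ≡ sumFrom 0 (suc r) (xCoeffTerm (suc r) m l)
  âStep-suc {r} m l m<1+r = case (suc l ℕₚ.≤? suc r ∸ m)
    where
    stepTerm = λ j → â (suc r) m j * recipℕ (suc j) * ℕ→ℚ (suc j C (suc j ∸ suc l)) * B⁺ (suc j ∸ suc l)
    inside : ∀ j → l ≤ j → j ≤ r ∸ m → xCoeffTerm (suc r) m l j ≡ stepTerm j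
    inside j l≤j _ = trans (if-true (≤ᵇ-true l≤j)) (solve 4 (λ a p c b → a :* (p :* c :* b) := a :* p :* c :* b) refl
      (â (suc r) m j) (recipℕ (suc j)) (ℕ→ℚ (suc j C (suc j ∸ suc l))) (B⁺ (suc j ∸ suc l)))
    case : Dec (suc l ≤ suc r ∸ m) → âStep (suc r) (â (suc r)) m (suc l) ≡ sumFrom 0 (suc r) (xCoeffTerm (suc r) m l)
    case (yes fits) = trans (if-true (trans (cong (_∧ (suc l ≤ᵇ suc r ∸ m)) (≤ᵇ-true m<1+r)) (≤ᵇ-true fits)))
      (sumRange-embed l (r ∸ m) (suc r) stepTerm (xCoeffTerm (suc r) m l) (s≤s (ℕₚ.m∸n≤m r m)) inside
        (λ { j _ (inj₁ j<l) → xCoeffTerm-vanishes (suc r) m l j (λ l≤j → contradiction l≤j (ℕₚ.<⇒≱ j<l))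
           ; j _ (inj₂ r∸m<j) → xCoeffTerm-vanishes (suc r) m l j (λ _ → ∸<⇒<+ r∸m<j) }))
    case (no ¬fits) = trans (if-false (trans (cong (_∧ (suc l ≤ᵇ suc r ∸ m)) (≤ᵇ-true m<1+r)) (≤ᵇ-false (ℕₚ.≰⇒> ¬fits))))
      (sym (sumFrom-zero 0 (suc r) {xCoeffTerm (suc r) m l} (λ j _ _ → xCoeffTerm-vanishes (suc r) m l j (λ l≤j →
        ℕₚ.≤-trans (ℕₚ.m≤n+m∸n (suc r) m) (ℕₚ.+-monoʳ-≤ m (ℕₚ.≤-trans (ℕₚ.≤-pred (ℕₚ.≰⇒> ¬fits)) l≤j))))))

  -- The polynomial behind the hyperharmonic numbers

  hyperPoly : ℕ → ℚ → ℚ → ℚ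
  hyperPoly r x Y = sumFrom 0 r (λ m → sumFrom 0 r (λ j → â r m j * (x ^ℚ j * Y ^ℚ m)))

  hyperPoly-suc-positive : ∀ r x Y →
    sumFrom 0 (suc (suc r)) (λ m → sumFrom 0 (suc r) (λ l → âStep (suc r) (â (suc r)) m (suc l) * (x ^ℚ suc l * Y ^ℚ m)))
    ≡ sumFrom 0 (suc r) (λ m → sumFrom 0 (suc r) (λ j → â (suc r) m j * (faulhaber j x * Y ^ℚ m)))
  hyperPoly-suc-positive r x Y = begin
    sumFrom 0 (suc R) row                  ≡⟨ sumFrom-last 0 R row ⟩
    sumFrom 0 R row + row R                ≡⟨ cong₂ _+_ (sumFrom-cong 0 R (λ m _ m<R → row≡ m m<R)) lastRow≡0 ⟩
    sumFrom 0 R target + 0ℚ                ≡⟨ ℚₚ.+-identityʳ (sumFrom 0 R target) ⟩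
    sumFrom 0 R target                     ∎
    where
    R = suc r
    P : ℕ → ℕ → ℚ
    P m l = x ^ℚ suc l * Y ^ℚ m
    row = λ m → sumFrom 0 R (λ l → âStep R (â R) m (suc l) * P m l)
    target = λ m → sumFrom 0 R (λ j → â R m j * (faulhaber j x * Y ^ℚ m))
    lastRow≡0 : row R ≡ 0ℚ
    lastRow≡0 = sumFrom-zero 0 R (λ l _ _ →
      trans (cong (_* P R l) (if-false (cong (_∧ (suc l ≤ᵇ R ∸ R)) (≤ᵇ-false (ℕₚ.n<1+n R))))) (ℚₚ.*-zeroˡ (P R l)))
    column : ∀ m j → j < R → â R m j * (faulhaber j x * Y ^ℚ m) ≡ sumFrom 0 R (λ l → xCoeffTerm R m l j * P m l)
    column m j j<R = begin
      â R m j * (faulhaber j x * Y ^ℚ m)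
        ≡⟨ cong (â R m j *_) (*-distribʳ-sumFrom 0 (suc j) (Y ^ℚ m) (λ l → faulhaberCoeff j l * x ^ℚ suc l)) ⟩
      â R m j * sumFrom 0 (suc j) (λ l → faulhaberCoeff j l * x ^ℚ suc l * Y ^ℚ m)
        ≡⟨ *-distribˡ-sumFrom 0 (suc j) (â R m j) (λ l → faulhaberCoeff j l * x ^ℚ suc l * Y ^ℚ m) ⟩
      sumFrom 0 (suc j) (λ l → â R m j * (faulhaberCoeff j l * x ^ℚ suc l * Y ^ℚ m))
        ≡⟨ sumFrom-embed 0 (suc j) R (λ l → â R m j * (faulhaberCoeff j l * x ^ℚ suc l * Y ^ℚ m)) (λ l → xCoeffTerm R m l j * P m l) j<R (λ _ ()) inside outside ⟩
      sumFrom 0 R (λ l → xCoeffTerm R m l j * P m l)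
        ∎
      where
      inside : ∀ l → 0 ≤ l → l < suc j → xCoeffTerm R m l j * P m l ≡ â R m j * (faulhaberCoeff j l * x ^ℚ suc l * Y ^ℚ m)
      inside l _ l<1+j = trans (cong (_* P m l) (if-true (≤ᵇ-true (ℕₚ.≤-pred l<1+j))))
        (solve 4 (λ a c p q → a :* c :* (p :* q) := a :* (c :* p :* q)) refl (â R m j) (faulhaberCoeff j l) (x ^ℚ suc l) (Y ^ℚ m))
      outside : ∀ l → suc j ≤ l → l < R → xCoeffTerm R m l j * P m l ≡ 0ℚ
      outside l j<l _ = trans (cong (_* P m l) (if-false (≤ᵇ-false j<l))) (ℚₚ.*-zeroˡ (P m l))
    row≡ : ∀ m → m < R → row m ≡ target m
    row≡ m m<R = begin
      sumFrom 0 R (λ l → âStep R (â R) m (suc l) * P m l)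
        ≡⟨ sumFrom-cong′ 0 R (λ l → trans (cong (_* P m l) (âStep-suc m l m<R)) (*-distribʳ-sumFrom 0 R (P m l) (λ j → xCoeffTerm R m l j))) ⟩
      sumFrom 0 R (λ l → sumFrom 0 R (λ j → xCoeffTerm R m l j * P m l))
        ≡⟨ sumFrom-comm 0 R 0 R (λ l j → xCoeffTerm R m l j * P m l) ⟩
      sumFrom 0 R (λ j → sumFrom 0 R (λ l → xCoeffTerm R m l j * P m l))
        ≡⟨ sumFrom-cong 0 R (λ j _ j<R → sym (column m j j<R)) ⟩
      target m
        ∎

  shiftedColumn : ℕ → ℕ → ℕ → ℚ
  shiftedColumn R v s = sumFrom 0 R (λ j → â R v j * shiftedFaulhaberCoeff j s)

  shiftedColumn-vanishes : ∀ R v s → R < v ℕ.+ s → shiftedColumn R v s ≡ 0ℚ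
  shiftedColumn-vanishes R v s R<v+s = sumFrom-zero 0 R {λ j → â R v j * shiftedFaulhaberCoeff j s} (λ j _ _ → term j)
    where
    term : ∀ j → â R v j * shiftedFaulhaberCoeff j s ≡ 0ℚ
    term j = case (R ℕₚ.≤? v ℕ.+ j)
      where
      case : Dec (R ≤ v ℕ.+ j) → â R v j * shiftedFaulhaberCoeff j s ≡ 0ℚ
      case (yes R≤v+j) = â*-vanishes {R} {v} {j} (shiftedFaulhaberCoeff j s) R≤v+j
      case (no R≰v+j) = trans (cong (â R v j *_) (shiftedFaulhaberCoeff-vanishes 1+j<s)) (ℚₚ.*-zeroʳ (â R v j))
        where
        1+j<s : suc j < s
        1+j<s = ℕₚ.+-cancelˡ-< v (suc j) s (ℕₚ.≤-<-trans (ℕₚ.≤-reflexive (ℕₚ.+-suc v j)) (ℕₚ.≤-<-trans (ℕₚ.≰⇒> R≰v+j) R<v+s))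

  âStep-zero-< : ∀ {r} m → m < suc r →
    âStep (suc r) (â (suc r)) m 0 ≡ - sumFrom 0 (suc m) (λ v → shiftedColumn (suc r) v (m ∸ v))
  âStep-zero-< {r} m m<R = trans (if-false (≡ᵇ-false (ℕₚ.<⇒≢ m<R))) (trans (if-true (≤ᵇ-true m<R))
          (cong -_ (sumFrom-cong 0 (suc m) (λ v _ v<1+m → column v (ℕₚ.≤-pred v<1+m)))))
    where
    column : ∀ v → v ≤ m → sumRange (m ∸ v ∸ 1) (r ∸ v) (λ j → â (suc r) v j * D (suc r) m j v) ≡ shiftedColumn (suc r) v (m ∸ v)
    column v v≤m = sumRange-embed (m ∸ v ∸ 1) (r ∸ v) (suc r) (λ j → â (suc r) v j * D (suc r) m j v) (λ j → â (suc r) v j * shiftedFaulhaberCoeff j (m ∸ v))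
      (s≤s (ℕₚ.m∸n≤m r v))
      (λ j _ _ → cong (â (suc r) v j *_) (sym (D≡shiftedFaulhaberCoeff {suc r} {m} {j} {v} v≤m)))
      (λ { j _ (inj₁ j<lo) → trans (cong (â (suc r) v j *_) (shiftedFaulhaberCoeff-vanishes (1+j<m∸v j<lo))) (ℚₚ.*-zeroʳ (â (suc r) v j))
         ; j _ (inj₂ r∸v<j) → â*-vanishes {suc r} {v} {j} (shiftedFaulhaberCoeff j (m ∸ v)) (∸<⇒<+ r∸v<j) })
      where
      1+j<m∸v : ∀ {j} → j < m ∸ v ∸ 1 → suc j < m ∸ v
      1+j<m∸v j<lo with m ∸ v
      ... | suc k = s≤s j<lo

  âStep-zero-≡ : ∀ r → âStep (suc r) (â (suc r)) (suc r) 0 ≡ - sumFrom 0 (suc (suc r)) (λ v → shiftedColumn (suc r) v (suc r ∸ v))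
  âStep-zero-≡ r = trans (if-true (≡ᵇ-refl R)) (cong -_ (sym (begin
    sumFrom 0 (suc R) (λ v → shiftedColumn R v (R ∸ v))
      ≡⟨ sumFrom-last 0 R (λ v → shiftedColumn R v (R ∸ v)) ⟩
    sumFrom 0 R (λ v → shiftedColumn R v (R ∸ v)) + shiftedColumn R R (R ∸ R)
      ≡⟨ cong₂ _+_ (sumFrom-cong 0 R (λ v _ v<R → diagonal v (ℕₚ.≤-pred v<R)))
                   (sumFrom-zero 0 R {λ j → â R R j * shiftedFaulhaberCoeff j (R ∸ R)} (λ j _ _ → â*-vanishes {R} {R} {j} (shiftedFaulhaberCoeff j (R ∸ R)) (ℕₚ.m≤m+n R j))) ⟩
    sumFrom 0 R (λ v → â R v (R ∸ v ∸ 1) * recipℕ (R ∸ v)) + 0ℚ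
      ≡⟨ ℚₚ.+-identityʳ (sumFrom 0 R (λ v → â R v (R ∸ v ∸ 1) * recipℕ (R ∸ v))) ⟩
    sumFrom 0 R (λ v → â R v (R ∸ v ∸ 1) * recipℕ (R ∸ v))
      ∎)))
    where
    R = suc r
    diagonal : ∀ v → v ≤ r → shiftedColumn R v (R ∸ v) ≡ â R v (R ∸ v ∸ 1) * recipℕ (R ∸ v)
    diagonal v v≤r = begin
      shiftedColumn R v (R ∸ v)
        ≡⟨ sumFrom-single 0 R (r ∸ v) (λ j → â R v j * shiftedFaulhaberCoeff j (R ∸ v)) z≤n (s≤s (ℕₚ.m∸n≤m r v)) offDiagonal ⟩
      â R v (r ∸ v) * shiftedFaulhaberCoeff (r ∸ v) (R ∸ v)
        ≡⟨ cong (λ s → â R v (r ∸ v) * shiftedFaulhaberCoeff (r ∸ v) s) R∸v≡1+r∸v ⟩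
      â R v (r ∸ v) * shiftedFaulhaberCoeff (r ∸ v) (suc (r ∸ v))
        ≡⟨ cong (â R v (r ∸ v) *_) (shiftedFaulhaberCoeff-top (r ∸ v)) ⟩
      â R v (r ∸ v) * recipℕ (suc (r ∸ v))
        ≡⟨ cong₂ (λ i k → â R v i * recipℕ k) (cong (_∸ 1) (sym R∸v≡1+r∸v)) (sym R∸v≡1+r∸v) ⟩
      â R v (R ∸ v ∸ 1) * recipℕ (R ∸ v)
        ∎
      where
      R∸v≡1+r∸v : R ∸ v ≡ suc (r ∸ v)
      R∸v≡1+r∸v = ℕₚ.+-∸-assoc 1 v≤r
      offDiagonal : ∀ j → 0 ≤ j → j < 0 ℕ.+ R → j ≢ r ∸ v → â R v j * shiftedFaulhaberCoeff j (R ∸ v) ≡ 0ℚ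
      offDiagonal j _ _ j≢r∸v = case (ℕₚ.<-cmp j (r ∸ v))
        where
        case : Tri (j < r ∸ v) (j ≡ r ∸ v) (r ∸ v < j) → â R v j * shiftedFaulhaberCoeff j (R ∸ v) ≡ 0ℚ
        case (tri< j<r∸v _ _) = trans (cong (â R v j *_) (shiftedFaulhaberCoeff-vanishes (subst (suc j <_) (sym R∸v≡1+r∸v) (s≤s j<r∸v))))
                               (ℚₚ.*-zeroʳ (â R v j))
        case (tri≈ _ j≡r∸v _) = contradiction j≡r∸v j≢r∸v
        case (tri> _ _ r∸v<j) = â*-vanishes {R} {v} {j} (shiftedFaulhaberCoeff j (R ∸ v)) (∸<⇒<+ r∸v<j)

  âStep-zero : ∀ {r} m → m ≤ suc r →
    âStep (suc r) (â (suc r)) m 0 ≡ - sumFrom 0 (suc m) (λ v → shiftedColumn (suc r) v (m ∸ v))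
  âStep-zero {r} m m≤1+r = [ âStep-zero-< m , top ]′ (ℕₚ.m≤n⇒m<n∨m≡n m≤1+r)
    where
    top : m ≡ suc r → âStep (suc r) (â (suc r)) m 0 ≡ - sumFrom 0 (suc m) (λ v → shiftedColumn (suc r) v (m ∸ v))
    top refl = âStep-zero-≡ r

  shiftedColumn-expansion : ∀ r Y →
    sumFrom 0 (suc r) (λ v → sumFrom 0 (suc r) (λ j → â (suc r) v j * (faulhaber j (Y - 1ℚ) * Y ^ℚ v)))
    ≡ sumFrom 0 (suc (suc r)) (λ v → sumFrom 0 (suc (suc r)) (λ s → shiftedColumn (suc r) v s * Y ^ℚ (v ℕ.+ s)))
  shiftedColumn-expansion r Y = begin
    sumFrom 0 R (λ v → sumFrom 0 R (λ j → â R v j * (faulhaber j (Y - 1ℚ) * Y ^ℚ v)))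
      ≡⟨ sumFrom-cong′ 0 R (λ v → sumFrom-cong 0 R (λ j _ j<R → expand v j j<R)) ⟩
    sumFrom 0 R (λ v → sumFrom 0 R (λ j → sumFrom 0 (suc R) (λ s → â R v j * shiftedFaulhaberCoeff j s * Y ^ℚ (v ℕ.+ s))))
      ≡⟨ sumFrom-cong′ 0 R (λ v → sumFrom-comm 0 R 0 (suc R) (λ j s → â R v j * shiftedFaulhaberCoeff j s * Y ^ℚ (v ℕ.+ s))) ⟩
    sumFrom 0 R (λ v → sumFrom 0 (suc R) (λ s → sumFrom 0 R (λ j → â R v j * shiftedFaulhaberCoeff j s * Y ^ℚ (v ℕ.+ s))))
      ≡⟨ sumFrom-cong′ 0 R (λ v → sumFrom-cong′ 0 (suc R) (λ s →
           sym (*-distribʳ-sumFrom 0 R (Y ^ℚ (v ℕ.+ s)) (λ j → â R v j * shiftedFaulhaberCoeff j s)))) ⟩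
    sumFrom 0 R (λ v → sumFrom 0 (suc R) (G v))
      ≡⟨ sym (trans (sumFrom-last 0 R (λ v → sumFrom 0 (suc R) (G v)))
                    (trans (cong (_+_ (sumFrom 0 R (λ v → sumFrom 0 (suc R) (G v)))) lastRowVanishes)
                           (ℚₚ.+-identityʳ (sumFrom 0 R (λ v → sumFrom 0 (suc R) (G v)))))) ⟩
    sumFrom 0 (suc R) (λ v → sumFrom 0 (suc R) (G v))
      ∎
    where
    R = suc r
    G : ℕ → ℕ → ℚ
    G v s = shiftedColumn R v s * Y ^ℚ (v ℕ.+ s)
    expand : ∀ v j → j < R → â R v j * (faulhaber j (Y - 1ℚ) * Y ^ℚ v)
                             ≡ sumFrom 0 (suc R) (λ s → â R v j * shiftedFaulhaberCoeff j s * Y ^ℚ (v ℕ.+ s))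
    expand v j j<R = begin
      â R v j * (faulhaber j (Y - 1ℚ) * Y ^ℚ v)
        ≡⟨ cong (λ w → â R v j * (w * Y ^ℚ v)) (faulhaber-shift Y j<R) ⟩
      â R v j * (sumFrom 0 (suc R) (λ s → shiftedFaulhaberCoeff j s * Y ^ℚ s) * Y ^ℚ v)
        ≡⟨ cong (â R v j *_) (*-distribʳ-sumFrom 0 (suc R) (Y ^ℚ v) (λ s → shiftedFaulhaberCoeff j s * Y ^ℚ s)) ⟩
      â R v j * sumFrom 0 (suc R) (λ s → shiftedFaulhaberCoeff j s * Y ^ℚ s * Y ^ℚ v)
        ≡⟨ *-distribˡ-sumFrom 0 (suc R) (â R v j) (λ s → shiftedFaulhaberCoeff j s * Y ^ℚ s * Y ^ℚ v) ⟩
      sumFrom 0 (suc R) (λ s → â R v j * (shiftedFaulhaberCoeff j s * Y ^ℚ s * Y ^ℚ v))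
        ≡⟨ sumFrom-cong′ 0 (suc R) (λ s → trans
             (solve 4 (λ a c p q → a :* (c :* p :* q) := a :* c :* (q :* p)) refl (â R v j) (shiftedFaulhaberCoeff j s) (Y ^ℚ s) (Y ^ℚ v))
             (cong (â R v j * shiftedFaulhaberCoeff j s *_) (sym (^-homo-* Y v s)))) ⟩
      sumFrom 0 (suc R) (λ s → â R v j * shiftedFaulhaberCoeff j s * Y ^ℚ (v ℕ.+ s))
        ∎
    lastRowVanishes : sumFrom 0 (suc R) (G R) ≡ 0ℚ
    lastRowVanishes = sumFrom-zero 0 (suc R) {G R} (λ s _ _ →
      trans (cong (_* Y ^ℚ (R ℕ.+ s)) (sumFrom-zero 0 R {λ j → â R R j * shiftedFaulhaberCoeff j s}
              (λ j _ _ → â*-vanishes {R} {R} {j} (shiftedFaulhaberCoeff j s) (ℕₚ.m≤m+n R j))))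
            (ℚₚ.*-zeroˡ (Y ^ℚ (R ℕ.+ s))))

  hyperPoly-suc-constant : ∀ r Y →
    sumFrom 0 (suc (suc r)) (λ m → âStep (suc r) (â (suc r)) m 0 * (1ℚ * Y ^ℚ m))
    ≡ - sumFrom 0 (suc r) (λ v → sumFrom 0 (suc r) (λ j → â (suc r) v j * (faulhaber j (Y - 1ℚ) * Y ^ℚ v)))
  hyperPoly-suc-constant r Y = begin
    sumFrom 0 (suc R) (λ m → âStep R (â R) m 0 * (1ℚ * Y ^ℚ m))
      ≡⟨ sumFrom-cong 0 (suc R) (λ m _ m<1+R → constant m (ℕₚ.≤-pred m<1+R)) ⟩
    sumFrom 0 (suc R) (λ m → - sumFrom 0 (suc m) (λ v → G v (m ∸ v)))
      ≡⟨ sym (neg-distrib-sumFrom 0 (suc R) (λ m → sumFrom 0 (suc m) (λ v → G v (m ∸ v)))) ⟩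
    - sumFrom 0 (suc R) (λ m → sumFrom 0 (suc m) (λ v → G v (m ∸ v)))
      ≡⟨ cong -_ (sumFrom-antidiagonal (suc R) G) ⟩
    - sumFrom 0 (suc R) (λ s → sumFrom 0 (suc R ∸ s) (λ v → G v s))
      ≡⟨ cong -_ (sumFrom-cong 0 (suc R) (λ s _ s<1+R → pad s (ℕₚ.≤-pred s<1+R))) ⟩
    - sumFrom 0 (suc R) (λ s → sumFrom 0 (suc R) (λ v → G v s))
      ≡⟨ cong -_ (sym (sumFrom-comm 0 (suc R) 0 (suc R) G)) ⟩
    - sumFrom 0 (suc R) (λ v → sumFrom 0 (suc R) (G v))
      ≡⟨ cong -_ (sym (shiftedColumn-expansion r Y)) ⟩
    - sumFrom 0 R (λ v → sumFrom 0 R (λ j → â R v j * (faulhaber j (Y - 1ℚ) * Y ^ℚ v)))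
      ∎
    where
    R = suc r
    G : ℕ → ℕ → ℚ
    G v s = shiftedColumn R v s * Y ^ℚ (v ℕ.+ s)
    constant : ∀ m → m ≤ R → âStep R (â R) m 0 * (1ℚ * Y ^ℚ m) ≡ - sumFrom 0 (suc m) (λ v → G v (m ∸ v))
    constant m m≤R = begin
      âStep R (â R) m 0 * (1ℚ * Y ^ℚ m)
        ≡⟨ cong (_* (1ℚ * Y ^ℚ m)) (âStep-zero m m≤R) ⟩
      - sumFrom 0 (suc m) (λ v → shiftedColumn R v (m ∸ v)) * (1ℚ * Y ^ℚ m)
        ≡⟨ solve 2 (λ s p → :- s :* (con 1ℚ :* p) := :- (s :* p)) refl (sumFrom 0 (suc m) (λ v → shiftedColumn R v (m ∸ v))) (Y ^ℚ m) ⟩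
      - (sumFrom 0 (suc m) (λ v → shiftedColumn R v (m ∸ v)) * Y ^ℚ m)
        ≡⟨ cong -_ (*-distribʳ-sumFrom 0 (suc m) (Y ^ℚ m) (λ v → shiftedColumn R v (m ∸ v))) ⟩
      - sumFrom 0 (suc m) (λ v → shiftedColumn R v (m ∸ v) * Y ^ℚ m)
        ≡⟨ cong -_ (sumFrom-cong 0 (suc m) (λ v _ v<1+m → cong (λ k → shiftedColumn R v (m ∸ v) * Y ^ℚ k)
                                                                (sym (ℕₚ.m+[n∸m]≡n (ℕₚ.≤-pred v<1+m))))) ⟩
      - sumFrom 0 (suc m) (λ v → G v (m ∸ v))
        ∎
    pad : ∀ s → s ≤ R → sumFrom 0 (suc R ∸ s) (λ v → G v s) ≡ sumFrom 0 (suc R) (λ v → G v s)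
    pad s s≤R = sym (trans (cong (λ n → sumFrom 0 n (λ v → G v s)) (sym (ℕₚ.m∸n+n≡m (ℕₚ.m≤n⇒m≤1+n s≤R))))
      (sumFrom-pad 0 (suc R ∸ s) s (λ v → G v s) (λ v 1+R∸s≤v _ →
        trans (cong (_* Y ^ℚ (v ℕ.+ s)) (shiftedColumn-vanishes R v s
                (subst (_≤ v ℕ.+ s) (ℕₚ.m∸n+n≡m (ℕₚ.m≤n⇒m≤1+n s≤R)) (ℕₚ.+-monoˡ-≤ s 1+R∸s≤v))))
              (ℚₚ.*-zeroˡ (Y ^ℚ (v ℕ.+ s))))))

  -- â(r+1,·,·) is chosen so that hyperPoly (r + 1) x Y = Σ â(r,m,j) (F_j(x) - F_j(Y - 1)) Y^m,
  -- with F_j the Faulhaber polynomial: the x^(l+1) coefficients match, and the constant term makes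
  -- the right-hand side vanish at x = Y - 1.
  hyperPoly-suc : ∀ r x Y → hyperPoly (suc (suc r)) x Y ≡
    sumFrom 0 (suc r) (λ m → sumFrom 0 (suc r) (λ j → â (suc r) m j * ((faulhaber j x - faulhaber j (Y - 1ℚ)) * Y ^ℚ m)))
  hyperPoly-suc r x Y = begin
    hyperPoly (suc R) x Y
      ≡⟨ sumFrom-cong′ 0 (suc R) (λ m → cong (_+_ (constant m)) (sumFrom-suc 0 R (λ j → â (suc R) m j * (x ^ℚ j * Y ^ℚ m)))) ⟩
    sumFrom 0 (suc R) (λ m → constant m + positive m)
      ≡⟨ sumFrom-+ 0 (suc R) constant positive ⟩
    sumFrom 0 (suc R) constant + sumFrom 0 (suc R) positive
      ≡⟨ cong₂ _+_ (hyperPoly-suc-constant r Y) (hyperPoly-suc-positive r x Y) ⟩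
    - sumFrom 0 R (λ m → sumFrom 0 R (atShift m)) + sumFrom 0 R (λ m → sumFrom 0 R (atX m))
      ≡⟨ ℚₚ.+-comm (- sumFrom 0 R (λ m → sumFrom 0 R (atShift m))) (sumFrom 0 R (λ m → sumFrom 0 R (atX m))) ⟩
    sumFrom 0 R (λ m → sumFrom 0 R (atX m)) - sumFrom 0 R (λ m → sumFrom 0 R (atShift m))
      ≡⟨ sumFrom-- 0 R (λ m → sumFrom 0 R (atX m)) (λ m → sumFrom 0 R (atShift m)) ⟩
    sumFrom 0 R (λ m → sumFrom 0 R (atX m) - sumFrom 0 R (atShift m))
      ≡⟨ sumFrom-cong′ 0 R (λ m → trans (sumFrom-- 0 R (atX m) (atShift m)) (sumFrom-cong′ 0 R (λ j →
           solve 4 (λ a f g p → a :* (f :* p) :- a :* (g :* p) := a :* ((f :- g) :* p)) refl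
             (â R m j) (faulhaber j x) (faulhaber j (Y - 1ℚ)) (Y ^ℚ m)))) ⟩
    sumFrom 0 R (λ m → sumFrom 0 R (λ j → â R m j * ((faulhaber j x - faulhaber j (Y - 1ℚ)) * Y ^ℚ m)))
      ∎
    where
    R = suc r
    constant = λ m → âStep R (â R) m 0 * (1ℚ * Y ^ℚ m)
    positive = λ m → sumFrom 0 R (λ l → âStep R (â R) m (suc l) * (x ^ℚ suc l * Y ^ℚ m))
    atX atShift : ℕ → ℕ → ℚ
    atX m j = â R m j * (faulhaber j x * Y ^ℚ m)
    atShift m j = â R m j * (faulhaber j (Y - 1ℚ) * Y ^ℚ m)

  hyperPoly-suc-sum : ∀ r N i → 1 ≤ i → i ≤ suc N →
    hyperPoly (suc (suc r)) (ℕ→ℚ N) (ℕ→ℚ i) ≡ sumRange i N (λ k → hyperPoly (suc r) (ℕ→ℚ k) (ℕ→ℚ i))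
  hyperPoly-suc-sum r N i 1≤i i≤1+N = begin
    hyperPoly (suc R) (ℕ→ℚ N) Y
      ≡⟨ hyperPoly-suc r (ℕ→ℚ N) Y ⟩
    sumFrom 0 R (λ m → sumFrom 0 R (λ j → â R m j * ((faulhaber j (ℕ→ℚ N) - faulhaber j (Y - 1ℚ)) * Y ^ℚ m)))
      ≡⟨ sumFrom-cong′ 0 R (λ m → sumFrom-cong′ 0 R (λ j → cong (λ w → â R m j * (w * Y ^ℚ m)) (faulhaber-range j N i 1≤i i≤1+N))) ⟩
    sumFrom 0 R (λ m → sumFrom 0 R (λ j → â R m j * (sumFrom i L (λ k → ℕ→ℚ k ^ℚ j) * Y ^ℚ m)))
      ≡⟨ sumFrom-cong′ 0 R (λ m → sumFrom-cong′ 0 R (λ j → trans (cong (â R m j *_) (*-distribʳ-sumFrom i L (Y ^ℚ m) (λ k → ℕ→ℚ k ^ℚ j)))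
           (*-distribˡ-sumFrom i L (â R m j) (λ k → ℕ→ℚ k ^ℚ j * Y ^ℚ m)))) ⟩
    sumFrom 0 R (λ m → sumFrom 0 R (λ j → sumFrom i L (λ k → â R m j * (ℕ→ℚ k ^ℚ j * Y ^ℚ m))))
      ≡⟨ sumFrom-cong′ 0 R (λ m → sumFrom-comm 0 R i L (λ j k → â R m j * (ℕ→ℚ k ^ℚ j * Y ^ℚ m))) ⟩
    sumFrom 0 R (λ m → sumFrom i L (λ k → sumFrom 0 R (λ j → â R m j * (ℕ→ℚ k ^ℚ j * Y ^ℚ m))))
      ≡⟨ sumFrom-comm 0 R i L (λ m k → sumFrom 0 R (λ j → â R m j * (ℕ→ℚ k ^ℚ j * Y ^ℚ m))) ⟩
    sumFrom i L (λ k → hyperPoly R (ℕ→ℚ k) Y)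
      ∎
    where
    R = suc r
    Y = ℕ→ℚ i
    L = suc N ∸ i

  HH≡∑hyperPoly : ∀ q r N → 1 ≤ r → HH q r N ≡ sumFrom 1 N (λ i → hyperPoly r (ℕ→ℚ N) (ℕ→ℚ i) * powNeg i q)
  HH≡∑hyperPoly q (suc zero) N _ = sumFrom-cong′ 1 N (λ i → sym (ℚₚ.*-identityˡ (powNeg i q)))
  HH≡∑hyperPoly q (suc (suc r)) N _ = begin
    sumFrom 1 N (λ k → HH q (suc r) k)
      ≡⟨ sumFrom-cong′ 1 N (λ k → HH≡∑hyperPoly q (suc r) k (s≤s z≤n)) ⟩
    sumFrom 1 N (λ k → sumFrom 1 k (λ i → hyperPoly (suc r) (ℕ→ℚ k) (ℕ→ℚ i) * powNeg i q))
      ≡⟨ sumFrom-triangle-comm₁ N (λ k i → hyperPoly (suc r) (ℕ→ℚ k) (ℕ→ℚ i) * powNeg i q) ⟩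
    sumFrom 1 N (λ i → sumFrom i (suc N ∸ i) (λ k → hyperPoly (suc r) (ℕ→ℚ k) (ℕ→ℚ i) * powNeg i q))
      ≡⟨ sumFrom-cong 1 N (λ i 1≤i i<1+N → trans (sym (*-distribʳ-sumFrom i (suc N ∸ i) (powNeg i q) (λ k → hyperPoly (suc r) (ℕ→ℚ k) (ℕ→ℚ i))))
           (cong (_* powNeg i q) (sym (hyperPoly-suc-sum r N i 1≤i (ℕₚ.m≤n⇒m≤1+n (ℕₚ.≤-pred i<1+N)))))) ⟩
    sumFrom 1 N (λ i → hyperPoly (suc (suc r)) (ℕ→ℚ N) (ℕ→ℚ i) * powNeg i q)
      ∎

  -- The coefficient of J ^ t in Σ_{i ≤ K} c_i (N - J)^i, as produced by the binomial theorem.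
  shiftCoeff : (ℕ → ℚ) → ℕ → ℕ → ℕ → ℚ
  shiftCoeff c N K t = sumRange t K (λ i → c i * ℕ→ℚ (i C t) * sgn t * ℕ→ℚ (N ℕ.^ (i ∸ t)))

  shiftCoeff-generating : ∀ c N J K L → J ≤ N → K < L →
    sumFrom 0 L (λ t → shiftCoeff c N K t * ℕ→ℚ J ^ℚ t) ≡ sumFrom 0 (suc K) (λ i → c i * ℕ→ℚ (N ∸ J) ^ℚ i)
  shiftCoeff-generating c N J K L J≤N K<L = begin
    sumFrom 0 L (λ t → shiftCoeff c N K t * ℕ→ℚ J ^ℚ t)
      ≡⟨ sumFrom-cong′ 0 L (λ t → trans (cong (_* ℕ→ℚ J ^ℚ t) (full t)) (*-distribʳ-sumFrom 0 (suc K) (ℕ→ℚ J ^ℚ t) (term t))) ⟩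
    sumFrom 0 L (λ t → sumFrom 0 (suc K) (λ i → term t i * ℕ→ℚ J ^ℚ t))
      ≡⟨ sumFrom-comm 0 L 0 (suc K) (λ t i → term t i * ℕ→ℚ J ^ℚ t) ⟩
    sumFrom 0 (suc K) (λ i → sumFrom 0 L (λ t → term t i * ℕ→ℚ J ^ℚ t))
      ≡⟨ sumFrom-cong 0 (suc K) (λ i _ i<1+K → column i (ℕₚ.<-≤-trans i<1+K K<L)) ⟩
    sumFrom 0 (suc K) (λ i → c i * ℕ→ℚ (N ∸ J) ^ℚ i)
      ∎
    where
    term : ℕ → ℕ → ℚ
    term t i = c i * ℕ→ℚ (i C t) * sgn t * ℕ→ℚ (N ℕ.^ (i ∸ t))
    term-vanishes : ∀ t i → i < t → term t i ≡ 0ℚ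
    term-vanishes t i i<t = trans (cong (λ b → c i * ℕ→ℚ b * sgn t * ℕ→ℚ (N ℕ.^ (i ∸ t))) (k>n⇒nCk≡0 i<t))
      (solve 3 (λ a b d → a :* con 0ℚ :* b :* d := con 0ℚ) refl (c i) (sgn t) (ℕ→ℚ (N ℕ.^ (i ∸ t))))
    full : ∀ t → shiftCoeff c N K t ≡ sumFrom 0 (suc K) (term t)
    full t = sumRange-embed t K (suc K) (term t) (term t) (ℕₚ.n<1+n K) (λ _ _ _ → refl)
      (λ { i _ (inj₁ i<t) → term-vanishes t i i<t
         ; i i<1+K (inj₂ K<i) → contradiction i<1+K (ℕₚ.<⇒≱ (s≤s K<i)) })
    column : ∀ i → i < L → sumFrom 0 L (λ t → term t i * ℕ→ℚ J ^ℚ t) ≡ c i * ℕ→ℚ (N ∸ J) ^ℚ i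
    column i i<L = begin
      sumFrom 0 L (λ t → term t i * ℕ→ℚ J ^ℚ t)
        ≡⟨ cong (λ l → sumFrom 0 l (λ t → term t i * ℕ→ℚ J ^ℚ t)) (sym (ℕₚ.m+[n∸m]≡n i<L)) ⟩
      sumFrom 0 (suc i ℕ.+ (L ∸ suc i)) (λ t → term t i * ℕ→ℚ J ^ℚ t)
        ≡⟨ sumFrom-pad 0 (suc i) (L ∸ suc i) (λ t → term t i * ℕ→ℚ J ^ℚ t)
             (λ t i<t _ → trans (cong (_* ℕ→ℚ J ^ℚ t) (term-vanishes t i i<t)) (ℚₚ.*-zeroˡ (ℕ→ℚ J ^ℚ t))) ⟩
      sumFrom 0 (suc i) (λ t → term t i * ℕ→ℚ J ^ℚ t)
        ≡⟨ sumFrom-cong′ 0 (suc i) binomialTerm ⟩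
      sumFrom 0 (suc i) (λ t → c i * (ℕ→ℚ (i C t) * ((- ℕ→ℚ J) ^ℚ t * ℕ→ℚ N ^ℚ (i ∸ t))))
        ≡⟨ sym (*-distribˡ-sumFrom 0 (suc i) (c i) (λ t → ℕ→ℚ (i C t) * ((- ℕ→ℚ J) ^ℚ t * ℕ→ℚ N ^ℚ (i ∸ t)))) ⟩
      c i * sumFrom 0 (suc i) (λ t → ℕ→ℚ (i C t) * ((- ℕ→ℚ J) ^ℚ t * ℕ→ℚ N ^ℚ (i ∸ t)))
        ≡⟨ cong (c i *_) (sym (binomial-theorem (- ℕ→ℚ J) (ℕ→ℚ N) i)) ⟩
      c i * (- ℕ→ℚ J + ℕ→ℚ N) ^ℚ i
        ≡⟨ cong (λ w → c i * w ^ℚ i) (trans (ℚₚ.+-comm (- ℕ→ℚ J) (ℕ→ℚ N)) (sym (ℕ→ℚ-∸ J≤N))) ⟩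
      c i * ℕ→ℚ (N ∸ J) ^ℚ i
        ∎
      where
      binomialTerm : ∀ t → term t i * ℕ→ℚ J ^ℚ t ≡ c i * (ℕ→ℚ (i C t) * ((- ℕ→ℚ J) ^ℚ t * ℕ→ℚ N ^ℚ (i ∸ t)))
      binomialTerm t = begin
        c i * ℕ→ℚ (i C t) * sgn t * ℕ→ℚ (N ℕ.^ (i ∸ t)) * ℕ→ℚ J ^ℚ t
          ≡⟨ cong (λ w → c i * ℕ→ℚ (i C t) * sgn t * w * ℕ→ℚ J ^ℚ t) (ℕ→ℚ-^ N (i ∸ t)) ⟩
        c i * ℕ→ℚ (i C t) * sgn t * ℕ→ℚ N ^ℚ (i ∸ t) * ℕ→ℚ J ^ℚ t
          ≡⟨ solve 5 (λ a b g m j → a :* b :* g :* m :* j := a :* (b :* ((g :* j) :* m))) refl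
               (c i) (ℕ→ℚ (i C t)) (sgn t) (ℕ→ℚ N ^ℚ (i ∸ t)) (ℕ→ℚ J ^ℚ t) ⟩
        c i * (ℕ→ℚ (i C t) * ((sgn t * ℕ→ℚ J ^ℚ t) * ℕ→ℚ N ^ℚ (i ∸ t)))
          ≡⟨ cong (λ w → c i * (ℕ→ℚ (i C t) * (w * ℕ→ℚ N ^ℚ (i ∸ t)))) (sym (neg-^ (ℕ→ℚ J) t)) ⟩
        c i * (ℕ→ℚ (i C t) * ((- ℕ→ℚ J) ^ℚ t * ℕ→ℚ N ^ℚ (i ∸ t)))
          ∎

  -- a₆ l n is (l+1)!⁻¹ times the re-expansion of the falling factorial x(x-1)⋯(x-l) at x = n + 1 - J.
  a₆-generating : ∀ l n J L → J ≤ suc n → suc (suc l) ≤ L →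
    sumFrom 0 L (λ t → a₆ l n t * ℕ→ℚ J ^ℚ t) ≡ ℕ→ℚ ((suc n ∸ J) C suc l)
  a₆-generating l n J L J≤1+n l+2≤L = begin
    sumFrom 0 L (λ t → recipℕ (suc l !) * shiftCoeff s (suc n) (suc l) t * ℕ→ℚ J ^ℚ t)
      ≡⟨ sumFrom-cong′ 0 L (λ t → ℚₚ.*-assoc (recipℕ (suc l !)) (shiftCoeff s (suc n) (suc l) t) (ℕ→ℚ J ^ℚ t)) ⟩
    sumFrom 0 L (λ t → recipℕ (suc l !) * (shiftCoeff s (suc n) (suc l) t * ℕ→ℚ J ^ℚ t))
      ≡⟨ sym (*-distribˡ-sumFrom 0 L (recipℕ (suc l !)) (λ t → shiftCoeff s (suc n) (suc l) t * ℕ→ℚ J ^ℚ t)) ⟩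
    recipℕ (suc l !) * sumFrom 0 L (λ t → shiftCoeff s (suc n) (suc l) t * ℕ→ℚ J ^ℚ t)
      ≡⟨ cong (recipℕ (suc l !) *_) (shiftCoeff-generating s (suc n) J (suc l) L J≤1+n l+2≤L) ⟩
    recipℕ (suc l !) * sumFrom 0 (suc (suc l)) (λ i → s i * ℕ→ℚ (suc n ∸ J) ^ℚ i)
      ≡⟨ cong (recipℕ (suc l !) *_) (∑s₁-^≡!*C (suc l) (suc n ∸ J)) ⟩
    recipℕ (suc l !) * (ℕ→ℚ (suc l !) * ℕ→ℚ ((suc n ∸ J) C suc l))
      ≡⟨ sym (ℚₚ.*-assoc (recipℕ (suc l !)) (ℕ→ℚ (suc l !)) (ℕ→ℚ ((suc n ∸ J) C suc l))) ⟩
    recipℕ (suc l !) * ℕ→ℚ (suc l !) * ℕ→ℚ ((suc n ∸ J) C suc l)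
      ≡⟨ cong (_* ℕ→ℚ ((suc n ∸ J) C suc l)) (recipℕ-inverseˡ (ℕₚ.1≤n! (suc l))) ⟩
    1ℚ * ℕ→ℚ ((suc n ∸ J) C suc l)
      ≡⟨ ℚₚ.*-identityˡ (ℕ→ℚ ((suc n ∸ J) C suc l)) ⟩
    ℕ→ℚ ((suc n ∸ J) C suc l)
      ∎
    where
    s : ℕ → ℚ
    s i = ℤ→ℚ (s₁ (suc l) i)

  a₆-vanishes : ∀ {l n t} → suc (suc l) ≤ t → a₆ l n t ≡ 0ℚ
  a₆-vanishes {l} {n} {t} l+2≤t = trans
    (cong (λ len → recipℕ (suc l !) * sumFrom t len (λ i → ℤ→ℚ (s₁ (suc l) i) * ℕ→ℚ (i C t) * sgn t * ℕ→ℚ (suc n ℕ.^ (i ∸ t))))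
          (ℕₚ.m≤n⇒m∸n≡0 l+2≤t))
    (ℚₚ.*-zeroʳ (recipℕ (suc l !)))

  a₇-vanishes : ∀ {P n t} → suc P < t → a₇ P n t ≡ 0ℚ
  a₇-vanishes {P} {n} {t} 1+P<t = sumFrom-zero 1 P {λ l → ℕ→ℚ (S₂ P l) * ℕ→ℚ (l !) * a₆ l n t} (λ l _ l<1+P →
    trans (cong (ℕ→ℚ (S₂ P l) * ℕ→ℚ (l !) *_) (a₆-vanishes (ℕₚ.≤-trans (s≤s (s≤s (ℕₚ.≤-pred l<1+P))) 1+P<t)))
          (ℚₚ.*-zeroʳ (ℕ→ℚ (S₂ P l) * ℕ→ℚ (l !))))

  -- Via x^P = Σ_l S(P,l) l! C(x,l) and the hockey stick identity.
  a₇-generating : ∀ P n J L → 1 ≤ P → J ≤ n → suc (suc P) ≤ L →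
    sumFrom 0 L (λ t → a₇ P n t * ℕ→ℚ J ^ℚ t) ≡ sumFrom 0 (suc (n ∸ J)) (λ x → ℕ→ℚ x ^ℚ P)
  a₇-generating P n J L 1≤P J≤n P+2≤L = begin
    sumFrom 0 L (λ t → a₇ P n t * ℕ→ℚ J ^ℚ t)
      ≡⟨ sumFrom-cong′ 0 L (λ t → *-distribʳ-sumFrom 1 P (ℕ→ℚ J ^ℚ t) (λ l → w l * a₆ l n t)) ⟩
    sumFrom 0 L (λ t → sumFrom 1 P (λ l → w l * a₆ l n t * ℕ→ℚ J ^ℚ t))
      ≡⟨ sumFrom-comm 0 L 1 P (λ t l → w l * a₆ l n t * ℕ→ℚ J ^ℚ t) ⟩
    sumFrom 1 P (λ l → sumFrom 0 L (λ t → w l * a₆ l n t * ℕ→ℚ J ^ℚ t))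
      ≡⟨ sumFrom-cong′ 1 P (λ l → trans (sumFrom-cong′ 0 L (λ t → ℚₚ.*-assoc (w l) (a₆ l n t) (ℕ→ℚ J ^ℚ t)))
                                         (sym (*-distribˡ-sumFrom 0 L (w l) (λ t → a₆ l n t * ℕ→ℚ J ^ℚ t)))) ⟩
    sumFrom 1 P (λ l → w l * sumFrom 0 L (λ t → a₆ l n t * ℕ→ℚ J ^ℚ t))
      ≡⟨ sumFrom-cong 1 P (λ l _ l<1+P → cong (w l *_) (trans
           (a₆-generating l n J L (ℕₚ.m≤n⇒m≤1+n J≤n) (ℕₚ.≤-trans (s≤s (s≤s (ℕₚ.≤-pred l<1+P))) P+2≤L))
           (trans (cong (λ m → ℕ→ℚ (m C suc l)) (ℕₚ.+-∸-assoc 1 J≤n)) (sym (hockey-stick (n ∸ J) l))))) ⟩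
    sumFrom 1 P (λ l → w l * sumFrom 0 (suc (n ∸ J)) (λ x → ℕ→ℚ (x C l)))
      ≡⟨ sumFrom-cong′ 1 P (λ l → *-distribˡ-sumFrom 0 (suc (n ∸ J)) (w l) (λ x → ℕ→ℚ (x C l))) ⟩
    sumFrom 1 P (λ l → sumFrom 0 (suc (n ∸ J)) (λ x → w l * ℕ→ℚ (x C l)))
      ≡⟨ sumFrom-comm 1 P 0 (suc (n ∸ J)) (λ l x → w l * ℕ→ℚ (x C l)) ⟩
    sumFrom 0 (suc (n ∸ J)) (λ x → sumFrom 1 P (λ l → w l * ℕ→ℚ (x C l)))
      ≡⟨ sumFrom-cong′ 0 (suc (n ∸ J)) (λ x → sym (trans (^≡∑S₂ P x) (dropZero x))) ⟩
    sumFrom 0 (suc (n ∸ J)) (λ x → ℕ→ℚ x ^ℚ P)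
      ∎
    where
    w : ℕ → ℚ
    w l = ℕ→ℚ (S₂ P l) * ℕ→ℚ (l !)
    dropZero : ∀ x → sumFrom 0 (suc P) (λ l → w l * ℕ→ℚ (x C l)) ≡ sumFrom 1 P (λ l → w l * ℕ→ℚ (x C l))
    dropZero x = trans (cong (λ s → ℕ→ℚ s * 1ℚ * 1ℚ + sumFrom 1 P (λ l → w l * ℕ→ℚ (x C l))) (S₂-zero-column 1≤P))
      (solve 1 (λ s → con 0ℚ :* con 1ℚ :* con 1ℚ :+ s := s) refl (sumFrom 1 P (λ l → w l * ℕ→ℚ (x C l))))

  a₈-generating : ∀ r m n x → x ≤ n → m < r →
    sumFrom 0 (r ∸ m) (λ k → a₈ r m k n * ℕ→ℚ x ^ℚ k) ≡ sumFrom 0 r (λ j → â r m j * ℕ→ℚ (n ∸ x) ^ℚ j)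
  a₈-generating r m n x x≤n m<r = begin
    sumFrom 0 (r ∸ m) (λ k → shiftCoeff (â r m) n (r ∸ 1 ∸ m) k * ℕ→ℚ x ^ℚ k)
      ≡⟨ shiftCoeff-generating (â r m) n x (r ∸ 1 ∸ m) (r ∸ m) x≤n (subst (r ∸ 1 ∸ m <_) (sym r∸m≡) (ℕₚ.n<1+n (r ∸ 1 ∸ m))) ⟩
    sumFrom 0 (suc (r ∸ 1 ∸ m)) (λ j → â r m j * ℕ→ℚ (n ∸ x) ^ℚ j)
      ≡⟨ cong (λ l → sumFrom 0 l (λ j → â r m j * ℕ→ℚ (n ∸ x) ^ℚ j)) (sym r∸m≡) ⟩
    sumFrom 0 (r ∸ m) (λ j → â r m j * ℕ→ℚ (n ∸ x) ^ℚ j)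
      ≡⟨ sym (trans (cong (λ l → sumFrom 0 l (λ j → â r m j * ℕ→ℚ (n ∸ x) ^ℚ j)) (sym (ℕₚ.m∸n+n≡m (ℕₚ.<⇒≤ m<r))))
                    (sumFrom-pad 0 (r ∸ m) m (λ j → â r m j * ℕ→ℚ (n ∸ x) ^ℚ j)
                      (λ j r∸m≤j _ → â*-vanishes {r} {m} {j} (ℕ→ℚ (n ∸ x) ^ℚ j)
                        (subst (_≤ m ℕ.+ j) (ℕₚ.m+[n∸m]≡n (ℕₚ.<⇒≤ m<r)) (ℕₚ.+-monoʳ-≤ m r∸m≤j))))) ⟩
    sumFrom 0 r (λ j → â r m j * ℕ→ℚ (n ∸ x) ^ℚ j)
      ∎
    where
    r∸m≡ : r ∸ m ≡ suc (r ∸ 1 ∸ m)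
    r∸m≡ = trans (ℕₚ.+-∸-assoc 1 m<r) (cong suc (sym (ℕₚ.∸-+-assoc r 1 m)))

  -- The generating polynomial of c

  cBlock : ℕ → ℕ → ℕ → ℕ → ℕ → ℚ
  cBlock p r n m t = sumRange (t ∸ (p ℕ.+ 1)) (r ∸ 1 ∸ m) (λ k → a₇ (p ℕ.+ k) n t * a₈ r m k n)

  r∸m≡1+r∸1∸m : ∀ {r m} → m < r → r ∸ m ≡ suc (r ∸ 1 ∸ m)
  r∸m≡1+r∸1∸m {r} {m} m<r = trans (ℕₚ.+-∸-assoc 1 m<r) (cong suc (sym (ℕₚ.∸-+-assoc r 1 m)))

  c-by-degree : ∀ p r n I → 1 ≤ r → sumFrom 0 (suc (p ℕ.+ r)) (λ y → c p r n y * I ^ℚ y)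
    ≡ sumFrom 0 r (λ m → sumFrom 0 (suc (p ℕ.+ r ∸ m)) (λ t → cBlock p r n m t * I ^ℚ (m ℕ.+ t)))
  c-by-degree p r n I 1≤r = begin
    sumFrom 0 (suc (p ℕ.+ r)) (λ y → c p r n y * I ^ℚ y)
      ≡⟨ sumFrom-cong′ 0 (suc (p ℕ.+ r)) (λ y → trans (*-distribʳ-sumFrom 0 (suc (r ∸ 1)) (I ^ℚ y) (λ m → sumRange 0 (p ℕ.+ r ∸ m) (δ m y)))
           (sumFrom-cong′ 0 (suc (r ∸ 1)) (λ m → *-distribʳ-sumFrom 0 (suc (p ℕ.+ r ∸ m)) (I ^ℚ y) (δ m y)))) ⟩
    sumFrom 0 (suc (p ℕ.+ r)) (λ y → sumFrom 0 (suc (r ∸ 1)) (λ m → sumFrom 0 (suc (p ℕ.+ r ∸ m)) (λ t → δ m y t * I ^ℚ y)))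
      ≡⟨ sumFrom-comm 0 (suc (p ℕ.+ r)) 0 (suc (r ∸ 1)) (λ y m → sumFrom 0 (suc (p ℕ.+ r ∸ m)) (λ t → δ m y t * I ^ℚ y)) ⟩
    sumFrom 0 (suc (r ∸ 1)) (λ m → sumFrom 0 (suc (p ℕ.+ r)) (λ y → sumFrom 0 (suc (p ℕ.+ r ∸ m)) (λ t → δ m y t * I ^ℚ y)))
      ≡⟨ sumFrom-cong 0 (suc (r ∸ 1)) (λ m _ m<1+[r∸1] → trans
           (sumFrom-comm 0 (suc (p ℕ.+ r)) 0 (suc (p ℕ.+ r ∸ m)) (λ y t → δ m y t * I ^ℚ y))
           (sumFrom-cong 0 (suc (p ℕ.+ r ∸ m)) (λ t _ t<1+p+r∸m → pick m t (subst (m <_) 1+[r∸1]≡r m<1+[r∸1]) (ℕₚ.≤-pred t<1+p+r∸m)))) ⟩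
    sumFrom 0 (suc (r ∸ 1)) (λ m → sumFrom 0 (suc (p ℕ.+ r ∸ m)) (λ t → K m t * I ^ℚ (m ℕ.+ t)))
      ≡⟨ cong (λ l → sumFrom 0 l (λ m → sumFrom 0 (suc (p ℕ.+ r ∸ m)) (λ t → K m t * I ^ℚ (m ℕ.+ t)))) 1+[r∸1]≡r ⟩
    sumFrom 0 r (λ m → sumFrom 0 (suc (p ℕ.+ r ∸ m)) (λ t → K m t * I ^ℚ (m ℕ.+ t)))
      ∎
    where
    K = cBlock p r n
    1+[r∸1]≡r : suc (r ∸ 1) ≡ r
    1+[r∸1]≡r = ℕₚ.m+[n∸m]≡n 1≤r
    δ : ℕ → ℕ → ℕ → ℚ
    δ m y t = if m ℕ.+ t ≡ᵇ y then K m t else 0ℚ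
    pick : ∀ m t → m < r → t ≤ p ℕ.+ r ∸ m →
           sumFrom 0 (suc (p ℕ.+ r)) (λ y → δ m y t * I ^ℚ y) ≡ K m t * I ^ℚ (m ℕ.+ t)
    pick m t m<r t≤ = trans (sumFrom-cong′ 0 (suc (p ℕ.+ r)) {g = λ y → if m ℕ.+ t ≡ᵇ y then K m t * I ^ℚ y else 0ℚ}
                                          (λ y → if-*-zero (m ℕ.+ t ≡ᵇ y) y))
      (sumFrom-indicator 0 (suc (p ℕ.+ r)) (m ℕ.+ t) (λ y → K m t * I ^ℚ y) z≤n
        (s≤s (subst (m ℕ.+ t ≤_) (ℕₚ.m+[n∸m]≡n (ℕₚ.≤-trans (ℕₚ.<⇒≤ m<r) (ℕₚ.m≤n+m r p))) (ℕₚ.+-monoʳ-≤ m t≤))))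
      where
      if-*-zero : ∀ b y → (if b then K m t else 0ℚ) * I ^ℚ y ≡ (if b then K m t * I ^ℚ y else 0ℚ)
      if-*-zero true y = refl
      if-*-zero false y = ℚₚ.*-zeroˡ (I ^ℚ y)

  cBlock-full : ∀ p r n m t → m < r → cBlock p r n m t ≡ sumFrom 0 (r ∸ m) (λ k → a₇ (p ℕ.+ k) n t * a₈ r m k n)
  cBlock-full p r n m t m<r = sumRange-embed (t ∸ (p ℕ.+ 1)) (r ∸ 1 ∸ m) (r ∸ m) g g (subst (r ∸ 1 ∸ m <_) (sym (r∸m≡1+r∸1∸m m<r)) (ℕₚ.n<1+n _)) (λ _ _ _ → refl)
     (λ { k _ (inj₁ k<lo) → trans (cong (_* a₈ r m k n) (a₇-vanishes (2+p+k≤t k k<lo))) (ℚₚ.*-zeroˡ (a₈ r m k n))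
        ; k k<r∸m (inj₂ r∸1∸m<k) → contradiction k<r∸m (ℕₚ.≤⇒≯ (subst (_≤ k) (sym (r∸m≡1+r∸1∸m m<r)) r∸1∸m<k)) })
    where
    g = λ k → a₇ (p ℕ.+ k) n t * a₈ r m k n
    2+p+k≤t : ∀ k → k < t ∸ (p ℕ.+ 1) → suc (p ℕ.+ k) < t
    2+p+k≤t k k<lo = subst (_≤ t) (reassoc k p) (ℕₚ.≤-trans (ℕₚ.+-monoˡ-≤ (p ℕ.+ 1) k<lo) (ℕₚ.≤-reflexive (ℕₚ.m∸n+n≡m p+1≤t)))
      where
      p+1≤t : p ℕ.+ 1 ≤ t
      p+1≤t = ℕₚ.<⇒≤ (ℕₚ.m∸n≢0⇒n<m (λ e → ℕₚ.<-irrefl (sym e) (ℕₚ.≤-<-trans z≤n k<lo)))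
      reassoc : ∀ k p → suc k ℕ.+ (p ℕ.+ 1) ≡ suc (suc (p ℕ.+ k))
      reassoc = solve-∀

  cBlock-row : ∀ p r n i m → 1 ≤ p → i ≤ n → m < r →
    sumFrom 0 (suc (p ℕ.+ r ∸ m)) (λ t → cBlock p r n m t * ℕ→ℚ i ^ℚ (m ℕ.+ t))
    ≡ ℕ→ℚ i ^ℚ m * sumFrom 0 (suc (n ∸ i)) (λ x → ℕ→ℚ x ^ℚ p * sumFrom 0 r (λ j → â r m j * ℕ→ℚ (n ∸ x) ^ℚ j))
  cBlock-row p r n i m 1≤p i≤n m<r = begin
    sumFrom 0 Lt (λ t → cBlock p r n m t * I ^ℚ (m ℕ.+ t))
      ≡⟨ sumFrom-cong′ 0 Lt (λ t → trans (cong₂ _*_ (cBlock-full p r n m t m<r) (^-homo-* I m t)) (*-distribʳ-sumFrom 0 Lk (I ^ℚ m * I ^ℚ t) (λ k → A k t * B k))) ⟩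
    sumFrom 0 Lt (λ t → sumFrom 0 Lk (λ k → A k t * B k * (I ^ℚ m * I ^ℚ t)))
      ≡⟨ sumFrom-comm 0 Lt 0 Lk (λ t k → A k t * B k * (I ^ℚ m * I ^ℚ t)) ⟩
    sumFrom 0 Lk (λ k → sumFrom 0 Lt (λ t → A k t * B k * (I ^ℚ m * I ^ℚ t)))
      ≡⟨ sumFrom-cong′ 0 Lk (λ k → trans (sumFrom-cong′ 0 Lt (λ t → solve 4 (λ a b u v → a :* b :* (u :* v) := (u :* b) :* (a :* v)) refl (A k t) (B k) (I ^ℚ m) (I ^ℚ t)))
           (sym (*-distribˡ-sumFrom 0 Lt (I ^ℚ m * B k) (λ t → A k t * I ^ℚ t)))) ⟩
    sumFrom 0 Lk (λ k → (I ^ℚ m * B k) * sumFrom 0 Lt (λ t → A k t * I ^ℚ t))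
      ≡⟨ sumFrom-cong 0 Lk (λ k _ k<Lk → cong (I ^ℚ m * B k *_) (a₇-generating (p ℕ.+ k) n i Lt (ℕₚ.≤-trans 1≤p (ℕₚ.m≤m+n p k)) i≤n (2+p+k≤Lt k k<Lk))) ⟩
    sumFrom 0 Lk (λ k → (I ^ℚ m * B k) * sumFrom 0 Lx (λ x → X x ^ℚ (p ℕ.+ k)))
      ≡⟨ sumFrom-cong′ 0 Lk (λ k → trans (*-distribˡ-sumFrom 0 Lx (I ^ℚ m * B k) (λ x → X x ^ℚ (p ℕ.+ k)))
           (sumFrom-cong′ 0 Lx (λ x → trans (cong (I ^ℚ m * B k *_) (^-homo-* (X x) p k))
              (solve 4 (λ u b P Q → (u :* b) :* (P :* Q) := u :* (P :* (b :* Q))) refl (I ^ℚ m) (B k) (X x ^ℚ p) (X x ^ℚ k))))) ⟩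
    sumFrom 0 Lk (λ k → sumFrom 0 Lx (λ x → I ^ℚ m * (X x ^ℚ p * (B k * X x ^ℚ k))))
      ≡⟨ sumFrom-comm 0 Lk 0 Lx (λ k x → I ^ℚ m * (X x ^ℚ p * (B k * X x ^ℚ k))) ⟩
    sumFrom 0 Lx (λ x → sumFrom 0 Lk (λ k → I ^ℚ m * (X x ^ℚ p * (B k * X x ^ℚ k))))
      ≡⟨ sumFrom-cong′ 0 Lx (λ x → trans (sym (*-distribˡ-sumFrom 0 Lk (I ^ℚ m) (λ k → X x ^ℚ p * (B k * X x ^ℚ k))))
           (cong (I ^ℚ m *_) (sym (*-distribˡ-sumFrom 0 Lk (X x ^ℚ p) (λ k → B k * X x ^ℚ k))))) ⟩
    sumFrom 0 Lx (λ x → I ^ℚ m * (X x ^ℚ p * sumFrom 0 Lk (λ k → B k * X x ^ℚ k)))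
      ≡⟨ sym (*-distribˡ-sumFrom 0 Lx (I ^ℚ m) (λ x → X x ^ℚ p * sumFrom 0 Lk (λ k → B k * X x ^ℚ k))) ⟩
    I ^ℚ m * sumFrom 0 Lx (λ x → X x ^ℚ p * sumFrom 0 Lk (λ k → B k * X x ^ℚ k))
      ≡⟨ cong (I ^ℚ m *_) (sumFrom-cong 0 Lx (λ x _ x<Lx → cong (X x ^ℚ p *_)
           (a₈-generating r m n x (ℕₚ.≤-trans (ℕₚ.≤-pred x<Lx) (ℕₚ.m∸n≤m n i)) m<r))) ⟩
    I ^ℚ m * sumFrom 0 Lx (λ x → X x ^ℚ p * sumFrom 0 r (λ j → â r m j * ℕ→ℚ (n ∸ x) ^ℚ j))
      ∎
    where
    I = ℕ→ℚ i
    X = ℕ→ℚ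
    Lt = suc (p ℕ.+ r ∸ m)
    Lk = r ∸ m
    Lx = suc (n ∸ i)
    A : ℕ → ℕ → ℚ
    A k t = a₇ (p ℕ.+ k) n t
    B : ℕ → ℚ
    B k = a₈ r m k n
    2+p+k≤Lt : ∀ k → k < r ∸ m → suc (suc (p ℕ.+ k)) ≤ Lt
    2+p+k≤Lt k k<r∸m = s≤s (subst (suc (p ℕ.+ k) ≤_) (sym (ℕₚ.+-∸-assoc p (ℕₚ.<⇒≤ m<r)))
                              (subst (_≤ p ℕ.+ (r ∸ m)) (ℕₚ.+-suc p k) (ℕₚ.+-monoʳ-≤ p k<r∸m)))

  c-generating : ∀ p r n i → 1 ≤ p → 1 ≤ r → i ≤ n →
    sumFrom 0 (suc (p ℕ.+ r)) (λ y → c p r n y * ℕ→ℚ i ^ℚ y)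
    ≡ sumFrom 0 (suc (n ∸ i)) (λ x → ℕ→ℚ x ^ℚ p * hyperPoly r (ℕ→ℚ (n ∸ x)) (ℕ→ℚ i))
  c-generating p r n i 1≤p 1≤r i≤n = begin
    sumFrom 0 (suc (p ℕ.+ r)) (λ y → c p r n y * I ^ℚ y)
      ≡⟨ c-by-degree p r n I 1≤r ⟩
    sumFrom 0 r (λ m → sumFrom 0 (suc (p ℕ.+ r ∸ m)) (λ t → cBlock p r n m t * I ^ℚ (m ℕ.+ t)))
      ≡⟨ sumFrom-cong 0 r (λ m _ m<r → cBlock-row p r n i m 1≤p i≤n m<r) ⟩
    sumFrom 0 r (λ m → I ^ℚ m * sumFrom 0 (suc (n ∸ i)) (λ x → X x ^ℚ p * S x m))
      ≡⟨ sumFrom-cong′ 0 r (λ m → *-distribˡ-sumFrom 0 (suc (n ∸ i)) (I ^ℚ m) (λ x → X x ^ℚ p * S x m)) ⟩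
    sumFrom 0 r (λ m → sumFrom 0 (suc (n ∸ i)) (λ x → I ^ℚ m * (X x ^ℚ p * S x m)))
      ≡⟨ sumFrom-comm 0 r 0 (suc (n ∸ i)) (λ m x → I ^ℚ m * (X x ^ℚ p * S x m)) ⟩
    sumFrom 0 (suc (n ∸ i)) (λ x → sumFrom 0 r (λ m → I ^ℚ m * (X x ^ℚ p * S x m)))
      ≡⟨ sumFrom-cong′ 0 (suc (n ∸ i)) column ⟩
    sumFrom 0 (suc (n ∸ i)) (λ x → X x ^ℚ p * hyperPoly r (ℕ→ℚ (n ∸ x)) I)
      ∎
    where
    I = ℕ→ℚ i
    X = ℕ→ℚ
    S : ℕ → ℕ → ℚ
    S x m = sumFrom 0 r (λ j → â r m j * ℕ→ℚ (n ∸ x) ^ℚ j)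
    column : ∀ x → sumFrom 0 r (λ m → I ^ℚ m * (X x ^ℚ p * S x m)) ≡ X x ^ℚ p * hyperPoly r (ℕ→ℚ (n ∸ x)) I
    column x = begin
      sumFrom 0 r (λ m → I ^ℚ m * (X x ^ℚ p * S x m))
        ≡⟨ sumFrom-cong′ 0 r (λ m → solve 3 (λ u P S → u :* (P :* S) := P :* (S :* u)) refl (I ^ℚ m) (X x ^ℚ p) (S x m)) ⟩
      sumFrom 0 r (λ m → X x ^ℚ p * (S x m * I ^ℚ m))
        ≡⟨ sym (*-distribˡ-sumFrom 0 r (X x ^ℚ p) (λ m → S x m * I ^ℚ m)) ⟩
      X x ^ℚ p * sumFrom 0 r (λ m → S x m * I ^ℚ m)
        ≡⟨ cong (X x ^ℚ p *_) (sumFrom-cong′ 0 r (λ m → trans (*-distribʳ-sumFrom 0 r (I ^ℚ m) (λ j → â r m j * ℕ→ℚ (n ∸ x) ^ℚ j))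
             (sumFrom-cong′ 0 r (λ j → ℚₚ.*-assoc (â r m j) (ℕ→ℚ (n ∸ x) ^ℚ j) (I ^ℚ m))))) ⟩
      X x ^ℚ p * hyperPoly r (ℕ→ℚ (n ∸ x)) I
        ∎

  recipℕ-*-cancelʳ : ∀ {a b} → 1 ≤ a → 1 ≤ b → recipℕ (a ℕ.* b) * ℕ→ℚ b ≡ recipℕ a
  recipℕ-*-cancelʳ {a} {b} 1≤a 1≤b = begin
    ρ * B                    ≡⟨ sym (ℚₚ.*-identityʳ (ρ * B)) ⟩
    ρ * B * 1ℚ               ≡⟨ cong (ρ * B *_) (sym (trans (ℚₚ.*-comm A σ) (recipℕ-inverseˡ 1≤a))) ⟩
    ρ * B * (A * σ)          ≡⟨ solve 4 (λ ρ B A σ → ρ :* B :* (A :* σ) := ρ :* (A :* B) :* σ) refl ρ B A σ ⟩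
    ρ * (A * B) * σ          ≡⟨ cong (λ w → ρ * w * σ) (sym (ℕ→ℚ-* a b)) ⟩
    ρ * ℕ→ℚ (a ℕ.* b) * σ    ≡⟨ cong (_* σ) (recipℕ-inverseˡ (ℕₚ.*-mono-≤ 1≤a 1≤b)) ⟩
    1ℚ * σ                   ≡⟨ ℚₚ.*-identityˡ σ ⟩
    σ                        ∎
    where
    ρ = recipℕ (a ℕ.* b)
    σ = recipℕ a
    A = ℕ→ℚ a
    B = ℕ→ℚ b

  1≤[1+j]^k : ∀ j k → 1 ≤ suc j ℕ.^ k
  1≤[1+j]^k j k = ℕₚ.m^n>0 (suc j) k

  powNeg-sub : ∀ j q y → powNeg (suc j) (+ q ℤ.- + y) ≡ powNeg (suc j) (+ q) * ℕ→ℚ (suc j) ^ℚ y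
  powNeg-sub j q y = trans (cong (powNeg J) (ℤₚ.[+m]-[+n]≡m⊖n q y)) (case (y ℕₚ.≤? q))
    where
    J = suc j
    case : Dec (y ≤ q) → powNeg J (q ℤ.⊖ y) ≡ recipℕ (J ℕ.^ q) * ℕ→ℚ J ^ℚ y
    case (yes y≤q) = begin
      powNeg J (q ℤ.⊖ y)                                   ≡⟨ cong (powNeg J) (ℤₚ.⊖-≥ y≤q) ⟩
      recipℕ (J ℕ.^ (q ∸ y))                               ≡⟨ sym (recipℕ-*-cancelʳ (1≤[1+j]^k j (q ∸ y)) (1≤[1+j]^k j y)) ⟩
      recipℕ (J ℕ.^ (q ∸ y) ℕ.* J ℕ.^ y) * ℕ→ℚ (J ℕ.^ y)   ≡⟨ cong₂ (λ a b → recipℕ a * b)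
                                                                (trans (sym (ℕₚ.^-distribˡ-+-* J (q ∸ y) y)) (cong (J ℕ.^_) (ℕₚ.m∸n+n≡m y≤q)))
                                                                (ℕ→ℚ-^ J y) ⟩
      recipℕ (J ℕ.^ q) * ℕ→ℚ J ^ℚ y                        ∎
    case (no y≰q) = begin
      powNeg J (q ℤ.⊖ y)                                   ≡⟨ cong (powNeg J) (ℤₚ.⊖-< q<y) ⟩
      powNeg J (ℤ.- (+ (y ∸ q)))                           ≡⟨ cong (λ k → powNeg J (ℤ.- (+ k))) y∸q≡ ⟩
      ℕ→ℚ (J ℕ.^ suc (y ∸ suc q))                          ≡⟨ cong (λ k → ℕ→ℚ (J ℕ.^ k)) (sym y∸q≡) ⟩
      ℕ→ℚ (J ℕ.^ (y ∸ q))                                  ≡⟨ sym (ℚₚ.*-identityˡ (ℕ→ℚ (J ℕ.^ (y ∸ q)))) ⟩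
      1ℚ * ℕ→ℚ (J ℕ.^ (y ∸ q))                             ≡⟨ cong (_* ℕ→ℚ (J ℕ.^ (y ∸ q))) (sym (recipℕ-inverseˡ (1≤[1+j]^k j q))) ⟩
      recipℕ (J ℕ.^ q) * ℕ→ℚ (J ℕ.^ q) * ℕ→ℚ (J ℕ.^ (y ∸ q))
        ≡⟨ ℚₚ.*-assoc (recipℕ (J ℕ.^ q)) (ℕ→ℚ (J ℕ.^ q)) (ℕ→ℚ (J ℕ.^ (y ∸ q))) ⟩
      recipℕ (J ℕ.^ q) * (ℕ→ℚ (J ℕ.^ q) * ℕ→ℚ (J ℕ.^ (y ∸ q)))
        ≡⟨ cong (recipℕ (J ℕ.^ q) *_) (sym (ℕ→ℚ-* (J ℕ.^ q) (J ℕ.^ (y ∸ q)))) ⟩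
      recipℕ (J ℕ.^ q) * ℕ→ℚ (J ℕ.^ q ℕ.* J ℕ.^ (y ∸ q))
        ≡⟨ cong (λ k → recipℕ (J ℕ.^ q) * ℕ→ℚ k) (trans (sym (ℕₚ.^-distribˡ-+-* J q (y ∸ q))) (cong (J ℕ.^_) (ℕₚ.m+[n∸m]≡n (ℕₚ.<⇒≤ q<y)))) ⟩
      recipℕ (J ℕ.^ q) * ℕ→ℚ (J ℕ.^ y)                     ≡⟨ cong (recipℕ (J ℕ.^ q) *_) (ℕ→ℚ-^ J y) ⟩
      recipℕ (J ℕ.^ q) * ℕ→ℚ J ^ℚ y                        ∎
      where
      q<y : q < y
      q<y = ℕₚ.≰⇒> y≰q
      y∸q≡ : y ∸ q ≡ suc (y ∸ suc q)
      y∸q≡ = ℕₚ.+-∸-assoc 1 q<y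

  powHyperConvolution : ℕ → ℕ → ℕ → ℕ → ℚ
  powHyperConvolution p r n i = sumFrom 0 (suc (n ∸ i)) (λ x → ℕ→ℚ x ^ℚ p * hyperPoly r (ℕ→ℚ (n ∸ x)) (ℕ→ℚ i))

  -- Only x = 0 contributes, and 0 ^ p = 0 as p ≥ 1.
  powHyperConvolution-diagonal : ∀ p r N → 1 ≤ p → powHyperConvolution p r N N ≡ 0ℚ
  powHyperConvolution-diagonal p r N 1≤p = begin
    sumFrom 0 (suc (N ∸ N)) (λ x → ℕ→ℚ x ^ℚ p * hyperPoly r (ℕ→ℚ (N ∸ x)) (ℕ→ℚ N))
      ≡⟨ cong (λ k → sumFrom 0 (suc k) (λ x → ℕ→ℚ x ^ℚ p * hyperPoly r (ℕ→ℚ (N ∸ x)) (ℕ→ℚ N))) (ℕₚ.n∸n≡0 N) ⟩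
    0ℚ ^ℚ p * hyperPoly r (ℕ→ℚ N) (ℕ→ℚ N) + 0ℚ
      ≡⟨ cong (λ z → z * hyperPoly r (ℕ→ℚ N) (ℕ→ℚ N) + 0ℚ) (0^p≡0 1≤p) ⟩
    0ℚ * hyperPoly r (ℕ→ℚ N) (ℕ→ℚ N) + 0ℚ
      ≡⟨ solve 1 (λ t → con 0ℚ :* t :+ con 0ℚ := con 0ℚ) refl (hyperPoly r (ℕ→ℚ N) (ℕ→ℚ N)) ⟩
    0ℚ
      ∎
    where
    0^p≡0 : ∀ {p} → 1 ≤ p → 0ℚ ^ℚ p ≡ 0ℚ
    0^p≡0 {suc p} _ = 0^suc p

  ∑c*H≡ : ∀ n p q r → 1 ≤ p → 1 ≤ r →
    sumRange 0 (p ℕ.+ r) (λ y → c p r (suc n) y * H (+ q ℤ.- + y) n)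
    ≡ sumFrom 1 n (λ i → powNeg i (+ q) * powHyperConvolution p r (suc n) i)
  ∑c*H≡ n p q r 1≤p 1≤r = begin
    sumFrom 0 (suc (p ℕ.+ r)) (λ y → c′ y * sumFrom 1 n (λ i → powNeg i (+ q ℤ.- + y)))
      ≡⟨ sumFrom-cong′ 0 (suc (p ℕ.+ r)) (λ y → trans (*-distribˡ-sumFrom 1 n (c′ y) (λ i → powNeg i (+ q ℤ.- + y)))
           (sumFrom-cong 1 n (λ i 1≤i _ → cong (c′ y *_) (split i y 1≤i)))) ⟩
    sumFrom 0 (suc (p ℕ.+ r)) (λ y → sumFrom 1 n (λ i → c′ y * (w i * ℕ→ℚ i ^ℚ y)))
      ≡⟨ sumFrom-comm 0 (suc (p ℕ.+ r)) 1 n (λ y i → c′ y * (w i * ℕ→ℚ i ^ℚ y)) ⟩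
    sumFrom 1 n (λ i → sumFrom 0 (suc (p ℕ.+ r)) (λ y → c′ y * (w i * ℕ→ℚ i ^ℚ y)))
      ≡⟨ sumFrom-cong 1 n (λ i _ i<1+n → trans
           (sumFrom-cong′ 0 (suc (p ℕ.+ r)) (λ y → solve 3 (λ c w x → c :* (w :* x) := w :* (c :* x)) refl (c′ y) (w i) (ℕ→ℚ i ^ℚ y)))
           (trans (sym (*-distribˡ-sumFrom 0 (suc (p ℕ.+ r)) (w i) (λ y → c′ y * ℕ→ℚ i ^ℚ y)))
                  (cong (w i *_) (c-generating p r (suc n) i 1≤p 1≤r (ℕₚ.m≤n⇒m≤1+n (ℕₚ.≤-pred i<1+n)))))) ⟩
    sumFrom 1 n (λ i → w i * powHyperConvolution p r (suc n) i)
      ∎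
    where
    c′ = c p r (suc n)
    w : ℕ → ℚ
    w i = powNeg i (+ q)
    split : ∀ i y → 1 ≤ i → powNeg i (+ q ℤ.- + y) ≡ w i * ℕ→ℚ i ^ℚ y
    split (suc i) y _ = powNeg-sub i q y

  ∑^*HH≡ : ∀ n p q r → 1 ≤ p → 1 ≤ r →
    sumRange 0 (suc n) (λ l → ℕ→ℚ (l ℕ.^ p) * HH (+ q) r (suc n ∸ l))
    ≡ sumFrom 1 n (λ i → powNeg i (+ q) * powHyperConvolution p r (suc n) i)
  ∑^*HH≡ n p q r 1≤p 1≤r = begin
    sumFrom 0 (suc N) (λ l → ℕ→ℚ (l ℕ.^ p) * HH (+ q) r (N ∸ l))
      ≡⟨ sumFrom-cong′ 0 (suc N) (λ l → trans (cong (ℕ→ℚ (l ℕ.^ p) *_) (HH≡∑hyperPoly (+ q) r (N ∸ l) 1≤r))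
           (trans (*-distribˡ-sumFrom 1 (N ∸ l) (ℕ→ℚ (l ℕ.^ p)) (λ i → hyperPoly r (ℕ→ℚ (N ∸ l)) (ℕ→ℚ i) * w i))
                  (sumFrom-suc 0 (N ∸ l) (λ i → ℕ→ℚ (l ℕ.^ p) * (hyperPoly r (ℕ→ℚ (N ∸ l)) (ℕ→ℚ i) * w i))))) ⟩
    sumFrom 0 (suc N) (λ l → sumFrom 0 (N ∸ l) (term l))
      ≡⟨ sumFrom-last 0 N (λ l → sumFrom 0 (N ∸ l) (term l)) ⟩
    sumFrom 0 N (λ l → sumFrom 0 (N ∸ l) (term l)) + sumFrom 0 (N ∸ N) (term N)
      ≡⟨ trans (cong (λ k → sumFrom 0 N (λ l → sumFrom 0 (N ∸ l) (term l)) + sumFrom 0 k (term N)) (ℕₚ.n∸n≡0 N))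
               (ℚₚ.+-identityʳ (sumFrom 0 N (λ l → sumFrom 0 (N ∸ l) (term l)))) ⟩
    sumFrom 0 N (λ l → sumFrom 0 (N ∸ l) (term l))
      ≡⟨ sumFrom-triangle-comm N (λ i′ l → term l i′) ⟩
    sumFrom 0 N (λ i′ → sumFrom 0 (N ∸ i′) (λ l → term l i′))
      ≡⟨ sumFrom-cong 0 N (λ i′ _ i′<N → column i′ i′<N) ⟩
    sumFrom 0 N (λ i′ → w (suc i′) * Q (suc i′))
      ≡⟨ sym (sumFrom-suc 0 N (λ i → w i * Q i)) ⟩
    sumFrom 1 (suc n) (λ i → w i * Q i)
      ≡⟨ sumFrom-last 1 n (λ i → w i * Q i) ⟩
    sumFrom 1 n (λ i → w i * Q i) + w N * Q N
      ≡⟨ cong (_+_ (sumFrom 1 n (λ i → w i * Q i))) (trans (cong (w N *_) (powHyperConvolution-diagonal p r N 1≤p)) (ℚₚ.*-zeroʳ (w N))) ⟩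
    sumFrom 1 n (λ i → w i * Q i) + 0ℚ
      ≡⟨ ℚₚ.+-identityʳ (sumFrom 1 n (λ i → w i * Q i)) ⟩
    sumFrom 1 n (λ i → w i * Q i)
      ∎
    where
    N = suc n
    w : ℕ → ℚ
    w i = powNeg i (+ q)
    Q = powHyperConvolution p r N
    term : ℕ → ℕ → ℚ
    term l i′ = ℕ→ℚ (l ℕ.^ p) * (hyperPoly r (ℕ→ℚ (N ∸ l)) (ℕ→ℚ (suc i′)) * w (suc i′))
    column : ∀ i′ → i′ < N → sumFrom 0 (N ∸ i′) (λ l → term l i′) ≡ w (suc i′) * Q (suc i′)
    column i′ i′<N = begin
      sumFrom 0 (N ∸ i′) (λ l → term l i′)
        ≡⟨ cong (λ k → sumFrom 0 k (λ l → term l i′)) (ℕₚ.+-∸-assoc 1 i′<N) ⟩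
      sumFrom 0 (suc (N ∸ suc i′)) (λ l → term l i′)
        ≡⟨ sumFrom-cong′ 0 (suc (N ∸ suc i′)) (λ l → trans (cong (_* (hyperPoly r (ℕ→ℚ (N ∸ l)) (ℕ→ℚ (suc i′)) * w (suc i′))) (ℕ→ℚ-^ l p))
             (solve 3 (λ a t v → a :* (t :* v) := v :* (a :* t)) refl (ℕ→ℚ l ^ℚ p) (hyperPoly r (ℕ→ℚ (N ∸ l)) (ℕ→ℚ (suc i′))) (w (suc i′)))) ⟩
      sumFrom 0 (suc (N ∸ suc i′)) (λ l → w (suc i′) * (ℕ→ℚ l ^ℚ p * hyperPoly r (ℕ→ℚ (N ∸ l)) (ℕ→ℚ (suc i′))))
        ≡⟨ sym (*-distribˡ-sumFrom 0 (suc (N ∸ suc i′)) (w (suc i′)) (λ l → ℕ→ℚ l ^ℚ p * hyperPoly r (ℕ→ℚ (N ∸ l)) (ℕ→ℚ (suc i′)))) ⟩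
      w (suc i′) * Q (suc i′)
        ∎

open import Data.Nat using (ℕ; suc; _≥_; _∸_; _^_; _+_)
open import Data.Integer using (+_) renaming (_-_ to _-ℤ_)
open import Data.Rational using (ℚ; _*_)
open import Relation.Binary.PropositionalEquality using (_≡_; sym; trans)
open HyperharmonicConvolution using (∑^*HH≡; ∑c*H≡)

theorem7 : (n p q r : ℕ) → n ≥ 1 → p ≥ 1 → q ≥ 1 → r ≥ 1 →
    sumRange 0 n (λ l → ℕ→ℚ (l ^ p) * HH (+ q) r (n ∸ l))
      ≡ sumRange 0 (p + r) (λ y → c p r n y * H (+ q -ℤ + y) (n ∸ 1))
theorem7 (suc n) p q r _ p≥1 _ r≥1 = trans (∑^*HH≡ n p q r p≥1 r≥1) (sym (∑c*H≡ n p q r p≥1 r≥1))
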